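{- Let $n\ge2$ and let $\mathcal M$ be the lattice described in the context. Let $\{a,b\}\subset\mathcal M$ be a diamond pair, written as $a=a_{i_1,\ldots,i_k}$, $b=a_{j_1,\ldots,j_l}$ and labeled so that one of the following holds: (1) $k=l$ and $i_r=j_r$ for all $r$ except exactly two values $r_1<r_2$, for which $i_{r_1}=j_{r_1}-1$ and $i_{r_2}=j_{r_2}+1$; or (2) $k=l+1$, $i_k=n$, and $i_r=j_r$ for all $1\le r\le l$ except exactly one value $r_1$, for which $i_{r_1}=j_{r_1}+1$. Then $\{a,b\}$ is special if and only if either we are in case (1) with $r_1=r_2-1$ and $j_{r_1}=j_{r_2}-1$, or we are in case (2) with $r_1=l$ and $j_{r_1}=n-2$.
   Context: Plücker setting: $R$ is the polynomial ring over $\mathbb{C}$ in the Plücker variables $X_{i_1,\ldots,i_k}$, $1\le k\le n-1$, $1\le i_1<\dots<i_k\le n$, and $I\subset R$ is the ideal of Plücker relations, i.e. the kernel of the homomorphism sending $X_{i_1,\ldots,i_k}$ to the determinant of the $k\times k$ matrix $(z_{r,i_s})_{1\le r,s\le k}$ in $\mathbb{C}[z_{i,j}:1\le i,j\le n]$. The lattice $\mathcal M$ has one element $a_{i_1,\ldots,i_k}$ for each Plücker variable, with $a_{i_1,\ldots,i_k}\le a_{j_1,\ldots,j_l}$ iff $k\ge l$ and $i_r\le j_r$ for $1\le r\le l$; it is a distributive lattice, and for $k\ge l$, $a_{i_1..i_k}\wedge a_{j_1..j_l}=a_{\min(i_1,j_1),\ldots,\min(i_l,j_l),i_{l+1},\ldots,i_k}$,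 $a_{i_1..i_k}\vee a_{j_1..j_l}=a_{\max(i_1,j_1),\ldots,\max(i_l,j_l)}$. Write $X_a$ for the Plücker variable corresponding to $a\in\mathcal M$. A diamond pair is a two-element set $\{a,b\}\subset\mathcal M$ such that $a\vee b$ covers $a$ and $b$ and both cover $a\wedge b$ (every diamond pair can be labeled so that (1) or (2) holds). Standard monomials $X_{c_1}\cdots X_{c_m}$, $c_1\le\dots\le c_m$, project to a basis of $R/I$; hence for incomparable $a,b$ there is a unique element of $I$ of the form $s(a,b)=X_aX_b-\sum_{i=0}^{m(a,b)}c_i(a,b)X_{p_i(a,b)}X_{q_i(a,b)}$ with pairwise distinct pairs, $p_i(a,b)<q_i(a,b)$, $c_i(a,b)\ne0$; one indexes so that $p_0=a\wedge b$, $q_0=a\vee b$, $c_0=1$. For a diamond pair, $m(a,b)=1$, so $s(a,b)$ has exactly one further term $X_{p_1(a,b)}X_{q_1(a,b)}$. A diamond pair $\{a,b\}$ is called special if $q_1(a,b)$ covers $a\vee b$. -}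

module Defs where

open import Data.Nat as ℕ using (ℕ; zero; suc; _+_; _∸_; _≤_; _<_; _⊓_; _⊔_)
open import Data.List using (List; []; _∷_; length; map)
open import Data.List.Relation.Unary.All using (All)
open import Data.List.Relation.Unary.Linked using (Linked)
open import Data.Rational as ℚ using (ℚ; 0ℚ; 1ℚ)
open import Data.Product using (Σ; _×_; _,_)
open import Data.Sum using (_⊎_; inj₁; inj₂)
open import Data.Unit using (⊤)
open import Data.Empty using (⊥)
open import Relation.Nullary using (¬_)
open import Relation.Binary.PropositionalEquality using (_≡_; _≢_)

-- An element a_{i_1,...,i_k} of the lattice M is represented by the list
-- i_1 ∷ ... ∷ i_k ∷ [] (entries 1-indexed, as in the paper).
Valid : ℕ → List ℕ → Set
Valid n xs = 1 ≤ length xs × length xs < n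
           × All (λ x → 1 ≤ x × x ≤ n) xs × Linked _<_ xs

_≼_ : List ℕ → List ℕ → Set
xs ≼ [] = ⊤
[] ≼ (y ∷ ys) = ⊥
(x ∷ xs) ≼ (y ∷ ys) = x ≤ y × xs ≼ ys

_≺_ : List ℕ → List ℕ → Set
xs ≺ ys = xs ≼ ys × xs ≢ ys

meet : List ℕ → List ℕ → List ℕ
meet [] ys = ys
meet (x ∷ xs) [] = x ∷ xs
meet (x ∷ xs) (y ∷ ys) = (x ⊓ y) ∷ meet xs ys

join : List ℕ → List ℕ → List ℕ
join [] ys = []
join (x ∷ xs) [] = []
join (x ∷ xs) (y ∷ ys) = (x ⊔ y) ∷ join xs ys

Covers : ℕ → List ℕ → List ℕ → Set
Covers n x y = x ≺ y × (∀ e → Valid n e → x ≼ e → e ≼ y → e ≡ x ⊎ e ≡ y)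

DiamondPair : ℕ → List ℕ → List ℕ → Set
DiamondPair n a b = Covers n a (join a b) × Covers n b (join a b)
                  × Covers n (meet a b) a × Covers n (meet a b) b

-- 0-indexed access (default 0), i.e. at xs r = i_{r+1}
at : List ℕ → ℕ → ℕ
at [] _ = 0
at (x ∷ xs) zero = x
at (x ∷ xs) (suc r) = at xs r

-- Determinants by Laplace expansion along the first row.
minors : List ℕ → List (ℕ × List ℕ)
minors [] = []
minors (c ∷ cs) = (c , cs) ∷ map (λ { (d , ds) → (d , c ∷ ds) }) (minors cs)

altSum : List ℚ → ℚ
altSum [] = 0ℚ
altSum (x ∷ xs) = x ℚ.- altSum xs

-- detF k z r cs : determinant of the k×k matrix (z_{r+u, cs_v}), u,v = 0..k-1
detF : ℕ → (ℕ → ℕ → ℚ) → ℕ → List ℕ → ℚ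
detF zero z r cs = 1ℚ
detF (suc k) z r cs =
  altSum (map (λ { (d , ds) → z r d ℚ.* detF k z (suc r) ds }) (minors cs))

-- Image of the Plücker variable X_{i_1..i_k} evaluated at the matrix z:
-- det (z_{r,i_s})_{1≤r,s≤k}
plucker : (ℕ → ℕ → ℚ) → List ℕ → ℚ
plucker z xs = detF (length xs) z 1 xs

-- X_a X_b - X_{a∧b} X_{a∨b} - c X_p X_q lies in the Plücker ideal I
-- (i.e. its image vanishes identically).
InPluckerIdeal : List ℕ → List ℕ → ℚ → List ℕ → List ℕ → Set
InPluckerIdeal a b c p q =
  ∀ (z : ℕ → ℕ → ℚ) →
    ((plucker z a ℚ.* plucker z b)
      ℚ.- (plucker z (meet a b) ℚ.* plucker z (join a b)))
      ℚ.- (c ℚ.* (plucker z p ℚ.* plucker z q)) ≡ 0ℚ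

-- For a diamond pair, s(a,b) = X_aX_b - X_{a∧b}X_{a∨b} - c_1 X_{p_1}X_{q_1};
-- the pair is special iff q_1 covers a∨b.
Special : ℕ → List ℕ → List ℕ → Set
Special n a b =
  Σ (List ℕ) λ p → Σ (List ℕ) λ q → Σ ℚ λ c →
    Valid n p × Valid n q × p ≺ q × ¬ (p ≡ meet a b × q ≡ join a b)
    × c ≢ 0ℚ × InPluckerIdeal a b c p q
    × Covers n (join a b) q

-- Case (1), with 0-indexed positions r1 < r2.
Case1 : List ℕ → List ℕ → Set
Case1 a b = length a ≡ length b ×
  Σ ℕ λ r1 → Σ ℕ λ r2 → r1 < r2 × r2 < length a
    × at a r1 + 1 ≡ at b r1 × at a r2 ≡ at b r2 + 1
    × (∀ r → r < length a → r ≢ r1 → r ≢ r2 → at a r ≡ at b r)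

-- Case (2), with 0-indexed position r1.
Case2 : ℕ → List ℕ → List ℕ → Set
Case2 n a b = length a ≡ suc (length b) × at a (length b) ≡ n ×
  Σ ℕ λ r1 → r1 < length b × at a r1 ≡ at b r1 + 1
    × (∀ r → r < length b → r ≢ r1 → at a r ≡ at b r)

Criterion : (n : ℕ) (a b : List ℕ) → Case1 a b ⊎ Case2 n a b → Set
Criterion n a b (inj₁ (_ , r1 , r2 , _)) = r2 ≡ suc r1 × at b r1 + 1 ≡ at b r2
Criterion n a b (inj₂ (_ , _ , r1 , _)) = suc r1 ≡ length b × at b r1 ≡ n ∸ 2

{-# OPTIONS --safe #-}
module Submission where

-- A special pair comes with a relation X_a X_b − X_{a∧b} X_{a∨b} − c X_p X_q = 0 in which q covers a∨b.
-- Doubling one column, or one row, of the matrix multiplies each Plücker coordinate by a power of 2 (how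
-- often the column occurs in it, or whether the row is among its rows). At a matrix where X_{a∧b} X_{a∨b}
-- vanishes but X_a X_b does not, the relation therefore forces X_p X_q to carry the weights of X_a X_b:
-- p and q have together the same entries and the same sizes as a and b. So q has the size of a∨b and
-- raises one entry x of it to x + 1, and counting entries gives x ∉ a∧b and x + 1 ∈ a∧b; in either
-- labelling only the configuration of the criterion allows this. Conversely, under the criterion s(a,b)
-- is a three-term Grassmann–Plücker relation with c = −1: the one between the minors A ++ u ∷ v ∷ C in
-- case (1), and the incidence relation between the minors A ++ x and A ++ y ∷ w in case (2).

open import Defs
open import Data.Nat as ℕ using (ℕ; zero; suc; _≤_; _<_; z≤n; s≤s; _⊓_; _⊔_; _∸_)
import Data.Nat.Properties as ℕ
open import Algebra.Properties.CommutativeSemigroup ℕ.+-commutativeSemigroup using (interchange; xy∙z≈xz∙y)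
open import Data.Empty using (⊥-elim)
open import Data.List using (List; []; _∷_; _++_; length; map; iterate)
open import Data.List.Membership.DecPropositional ℕ._≟_ using (_∈?_)
open import Data.List.Membership.Propositional using (_∈_; _∉_)
open import Data.List.Membership.Propositional.Properties using (∈-++⁺ˡ; ∈-++⁺ʳ; ∈-++⁻; ∈-∃++)
open import Data.List.Properties
  using (length-++; length-++-sucʳ; ++-assoc; ++-identityʳ; ++-cancelˡ; map-∘; ∷-injectiveˡ; ∷-injectiveʳ; ≡-dec)
open import Data.List.Relation.Unary.All as All using (All; []; _∷_)
open import Data.List.Relation.Unary.All.Properties using (All¬⇒¬Any; ++⁺; ++⁻ˡ; ++⁻ʳ)
open import Data.List.Relation.Unary.AllPairs as AllPairs using (AllPairs; []; _∷_)
open import Data.List.Relation.Unary.Any using (here; there)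
open import Data.List.Relation.Unary.Linked using (Linked; []; [-]; _∷_)
open import Data.List.Relation.Unary.Linked.Properties using (Linked⇒AllPairs; AllPairs⇒Linked)
import Data.Nat.Tactic.RingSolver as ℕ-Solver
open import Data.Product using (∃; _×_; _,_; proj₁; proj₂; map₁)
open import Data.Rational using (ℚ; 0ℚ; 1ℚ; ½; _+_; _*_; _-_; -_; 1/_; ≢-nonZero)
import Data.Rational.Properties as ℚ
open import Data.Rational.Solver using (module +-*-Solver)
open import Data.Sum using (_⊎_; inj₁; inj₂)
open import Data.Unit using (tt)
open import Function using (_∘_)
open import Function.Bundles using (_⇔_; mk⇔)
open import Function.Properties.Equivalence using () renaming (trans to ⇔-trans)
open import Relation.Binary.PropositionalEquality
open import Relation.Nullary using (¬_; yes; no)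

open +-*-Solver
open ≡-Reasoning

-- Laplace expansion

sign : ℕ → ℚ
sign zero = 1ℚ
sign (suc n) = - sign n

sign-square : ∀ n → sign n * sign n ≡ 1ℚ
sign-square zero = refl
sign-square (suc n) = trans (solve 1 (λ x → :- x :* :- x := x :* x) refl (sign n)) (sign-square n)

sign-cancel : ∀ n {x} → sign n * x ≡ 0ℚ → x ≡ 0ℚ
sign-cancel n {x} sx≡0 = begin
  x                      ≡⟨ solve 1 (λ x → x := con 1ℚ :* x) refl x ⟩
  1ℚ * x                 ≡⟨ cong (_* x) (sign-square n) ⟨
  sign n * sign n * x    ≡⟨ ℚ.*-assoc (sign n) (sign n) x ⟩
  sign n * (sign n * x)  ≡⟨ cong (sign n *_) sx≡0 ⟩
  sign n * 0ℚ            ≡⟨ ℚ.*-zeroʳ (sign n) ⟩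
  0ℚ                     ∎

sign-+ : ∀ m n → sign (m ℕ.+ n) ≡ sign m * sign n
sign-+ zero n = sym (ℚ.*-identityˡ (sign n))
sign-+ (suc m) n = trans (cong -_ (sign-+ m n)) (ℚ.neg-distribˡ-* (sign m) (sign n))

sign-≢0 : ∀ n → sign n ≢ 0ℚ
sign-≢0 n sign≡0 = ℚ.1≢0 (trans (sym (sign-square n)) (trans (cong (sign n *_) sign≡0) (ℚ.*-zeroʳ (sign n))))

-- expand f g L = Σᵢ (−1)ⁱ f(Lᵢ) g(L without Lᵢ), so that detF (suc k) z r = expand (z r) (detF k z (suc r)).
expand : (ℕ → ℚ) → (List ℕ → ℚ) → List ℕ → ℚ
expand f g L = altSum (map (λ (d , ds) → f d * g ds) (minors L))

expand-∷ : ∀ f g c L → expand f g (c ∷ L) ≡ f c * g L - expand f (λ es → g (c ∷ es)) L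
expand-∷ f g c L = cong (λ t → f c * g L - altSum t) (sym (map-∘ (minors L)))

expand-congʳ : ∀ f {g h} L → (∀ es → length es < length L → g es ≡ h es) → expand f g L ≡ expand f h L
expand-congʳ f [] eq = refl
expand-congʳ f {g} {h} (c ∷ L) eq = begin
  expand f g (c ∷ L)                            ≡⟨ expand-∷ f g c L ⟩
  f c * g L - expand f (λ es → g (c ∷ es)) L
    ≡⟨ cong₂ (λ u v → f c * u - v) (eq L ℕ.≤-refl) (expand-congʳ f L (λ es lt → eq (c ∷ es) (s≤s lt))) ⟩
  f c * h L - expand f (λ es → h (c ∷ es)) L    ≡⟨ expand-∷ f h c L ⟨
  expand f h (c ∷ L)                            ∎

expand-congˡ : ∀ {f f′} g L → (∀ d → f d ≡ f′ d) → expand f g L ≡ expand f′ g L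
expand-congˡ g [] eq = refl
expand-congˡ {f} {f′} g (c ∷ L) eq = begin
  expand f g (c ∷ L)                              ≡⟨ expand-∷ f g c L ⟩
  f c * g L - expand f (λ es → g (c ∷ es)) L      ≡⟨ cong₂ (λ u v → u * g L - v) (eq c) (expand-congˡ _ L eq) ⟩
  f′ c * g L - expand f′ (λ es → g (c ∷ es)) L    ≡⟨ expand-∷ f′ g c L ⟨
  expand f′ g (c ∷ L)                             ∎

expand-linearˡ : ∀ c φ ψ g L → expand (λ d → c * φ d - ψ d) g L ≡ c * expand φ g L - expand ψ g L
expand-linearˡ c φ ψ g [] = solve 1 (λ c → con 0ℚ := c :* con 0ℚ :- con 0ℚ) refl c
expand-linearˡ c φ ψ g (e ∷ L) = begin
  expand (λ d → c * φ d - ψ d) g (e ∷ L)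
    ≡⟨ expand-∷ (λ d → c * φ d - ψ d) g e L ⟩
  (c * φ e - ψ e) * g L - expand (λ d → c * φ d - ψ d) g′ L
    ≡⟨ cong (λ t → (c * φ e - ψ e) * g L - t) (expand-linearˡ c φ ψ g′ L) ⟩
  (c * φ e - ψ e) * g L - (c * expand φ g′ L - expand ψ g′ L)
    ≡⟨ solve 6 (λ c x y u X Y → (c :* x :- y) :* u :- (c :* X :- Y) := c :* (x :* u :- X) :- (y :* u :- Y))
             refl c (φ e) (ψ e) (g L) (expand φ g′ L) (expand ψ g′ L) ⟩
  c * (φ e * g L - expand φ g′ L) - (ψ e * g L - expand ψ g′ L)
    ≡⟨ cong₂ (λ u v → c * u - v) (expand-∷ φ g e L) (expand-∷ ψ g e L) ⟨
  c * expand φ g (e ∷ L) - expand ψ g (e ∷ L) ∎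
  where g′ = λ es → g (e ∷ es)

expand-linearʳ : ∀ f c g h L → expand f (λ es → c * g es - h es) L ≡ c * expand f g L - expand f h L
expand-linearʳ f c g h [] = solve 1 (λ c → con 0ℚ := c :* con 0ℚ :- con 0ℚ) refl c
expand-linearʳ f c g h (e ∷ L) = begin
  expand f (λ es → c * g es - h es) (e ∷ L)
    ≡⟨ expand-∷ f _ e L ⟩
  f e * (c * g L - h L) - expand f (λ es → c * g (e ∷ es) - h (e ∷ es)) L
    ≡⟨ cong (λ t → f e * (c * g L - h L) - t) (expand-linearʳ f c _ _ L) ⟩
  f e * (c * g L - h L) - (c * expand f g′ L - expand f h′ L)
    ≡⟨ solve 6 (λ c x u v X Y → x :* (c :* u :- v) :- (c :* X :- Y) := c :* (x :* u :- X) :- (x :* v :- Y))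
             refl c (f e) (g L) (h L) (expand f g′ L) (expand f h′ L) ⟩
  c * (f e * g L - expand f g′ L) - (f e * h L - expand f h′ L)
    ≡⟨ cong₂ (λ u v → c * u - v) (expand-∷ f g e L) (expand-∷ f h e L) ⟨
  c * expand f g (e ∷ L) - expand f h (e ∷ L) ∎
  where
  g′ = λ es → g (e ∷ es)
  h′ = λ es → h (e ∷ es)

expand-negʳ : ∀ f g L → expand f (λ es → - g es) L ≡ - expand f g L
expand-negʳ f g L = begin
  expand f (λ es → - g es) L
    ≡⟨ expand-congʳ f L (λ es _ → solve 1 (λ u → :- u := con 0ℚ :* con 0ℚ :- u) refl (g es)) ⟩
  expand f (λ es → 0ℚ * 0ℚ - g es) L
    ≡⟨ expand-linearʳ f 0ℚ (λ _ → 0ℚ) g L ⟩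
  0ℚ * expand f (λ _ → 0ℚ) L - expand f g L
    ≡⟨ solve 2 (λ u v → con 0ℚ :* u :- v := :- v) refl (expand f (λ _ → 0ℚ) L) (expand f g L) ⟩
  - expand f g L ∎

expand-vanishingˡ : ∀ {f} g L → All (λ d → f d ≡ 0ℚ) L → expand f g L ≡ 0ℚ
expand-vanishingˡ g [] [] = refl
expand-vanishingˡ {f} g (c ∷ L) (fc≡0 ∷ f≡0) = begin
  expand f g (c ∷ L)                          ≡⟨ expand-∷ f g c L ⟩
  f c * g L - expand f (λ es → g (c ∷ es)) L  ≡⟨ cong₂ (λ u v → u * g L - v) fc≡0 (expand-vanishingˡ _ L f≡0) ⟩
  0ℚ * g L - 0ℚ                               ≡⟨ solve 1 (λ x → con 0ℚ :* x :- con 0ℚ := con 0ℚ) refl (g L) ⟩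
  0ℚ                                          ∎

expand-zeroʳ : ∀ f L → expand f (λ _ → 0ℚ) L ≡ 0ℚ
expand-zeroʳ f [] = refl
expand-zeroʳ f (c ∷ L) = begin
  expand f (λ _ → 0ℚ) (c ∷ L)           ≡⟨ expand-∷ f _ c L ⟩
  f c * 0ℚ - expand f (λ _ → 0ℚ) L      ≡⟨ cong (λ t → f c * 0ℚ - t) (expand-zeroʳ f L) ⟩
  f c * 0ℚ - 0ℚ                         ≡⟨ solve 1 (λ x → x :* con 0ℚ :- con 0ℚ := con 0ℚ) refl (f c) ⟩
  0ℚ                                    ∎

expand-scaleʳ : ∀ f c g L → expand f (λ es → c * g es) L ≡ c * expand f g L
expand-scaleʳ f c g L = begin
  expand f (λ es → c * g es) L
    ≡⟨ expand-congʳ f L (λ es _ → solve 2 (λ c x → c :* x := c :* x :- con 0ℚ) refl c (g es)) ⟩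
  expand f (λ es → c * g es - 0ℚ) L
    ≡⟨ expand-linearʳ f c g (λ _ → 0ℚ) L ⟩
  c * expand f g L - expand f (λ _ → 0ℚ) L
    ≡⟨ cong (λ t → c * expand f g L - t) (expand-zeroʳ f L) ⟩
  c * expand f g L - 0ℚ
    ≡⟨ solve 2 (λ c x → c :* x :- con 0ℚ := c :* x) refl c (expand f g L) ⟩
  c * expand f g L ∎

expand-scaleˡ : ∀ c f g L → expand (λ d → c * f d) g L ≡ c * expand f g L
expand-scaleˡ c f g L = begin
  expand (λ d → c * f d) g L
    ≡⟨ expand-congˡ g L (λ d → solve 2 (λ c x → c :* x := c :* x :- con 0ℚ) refl c (f d)) ⟩
  expand (λ d → c * f d - 0ℚ) g L
    ≡⟨ expand-linearˡ c f (λ _ → 0ℚ) g L ⟩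
  c * expand f g L - expand (λ _ → 0ℚ) g L
    ≡⟨ cong (λ t → c * expand f g L - t) (expand-vanishingˡ g L (All.universal (λ _ → refl) L)) ⟩
  c * expand f g L - 0ℚ
    ≡⟨ solve 2 (λ c x → c :* x :- con 0ℚ := c :* x) refl c (expand f g L) ⟩
  c * expand f g L ∎

expand-++ : ∀ f g A L →
  expand f g (A ++ L) ≡ expand f (λ es → g (es ++ L)) A + sign (length A) * expand f (λ es → g (A ++ es)) L
expand-++ f g [] L = solve 1 (λ x → x := con 0ℚ :+ con 1ℚ :* x) refl (expand f g L)
expand-++ f g (a ∷ A) L = begin
  expand f g (a ∷ A ++ L)
    ≡⟨ expand-∷ f g a (A ++ L) ⟩
  f a * g (A ++ L) - expand f (λ es → g (a ∷ es)) (A ++ L)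
    ≡⟨ cong (λ t → f a * g (A ++ L) - t) (expand-++ f _ A L) ⟩
  f a * g (A ++ L) - (expand f (λ es → g (a ∷ es ++ L)) A + s * R)
    ≡⟨ solve 4 (λ x y s r → x :- (y :+ s :* r) := (x :- y) :+ (:- s) :* r) refl (f a * g (A ++ L)) _ s R ⟩
  (f a * g (A ++ L) - expand f (λ es → g (a ∷ es ++ L)) A) + - s * R
    ≡⟨ cong (_+ - s * R) (expand-∷ f (λ es → g (es ++ L)) a A) ⟨
  expand f (λ es → g (es ++ L)) (a ∷ A) + - s * R ∎
  where
  s = sign (length A)
  R = expand f (λ es → g (a ∷ A ++ es)) L

expand-single : ∀ {f} g X s Y → All (λ d → f d ≡ 0ℚ) X → All (λ d → f d ≡ 0ℚ) Y →
  expand f g (X ++ s ∷ Y) ≡ sign (length X) * (f s * g (X ++ Y))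
expand-single {f} g X s Y f≡0ˣ f≡0ʸ = begin
  expand f g (X ++ s ∷ Y)
    ≡⟨ expand-++ f g X (s ∷ Y) ⟩
  expand f _ X + sign (length X) * expand f _ (s ∷ Y)
    ≡⟨ cong₂ (λ u v → u + sign (length X) * v) (expand-vanishingˡ _ X f≡0ˣ) (expand-∷ f _ s Y) ⟩
  0ℚ + sign (length X) * (f s * g (X ++ Y) - expand f _ Y)
    ≡⟨ cong (λ t → 0ℚ + sign (length X) * (f s * g (X ++ Y) - t)) (expand-vanishingˡ _ Y f≡0ʸ) ⟩
  0ℚ + sign (length X) * (f s * g (X ++ Y) - 0ℚ)
    ≡⟨ solve 2 (λ a b → con 0ℚ :+ a :* (b :- con 0ℚ) := a :* b) refl (sign (length X)) _ ⟩
  sign (length X) * (f s * g (X ++ Y)) ∎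

data AdjacentSwap : List ℕ → List ℕ → Set where
  here  : ∀ x y L → AdjacentSwap (x ∷ y ∷ L) (y ∷ x ∷ L)
  there : ∀ p {L L′} → AdjacentSwap L L′ → AdjacentSwap (p ∷ L) (p ∷ L′)

adjacentSwap-++ : ∀ P x y R → AdjacentSwap (P ++ x ∷ y ∷ R) (P ++ y ∷ x ∷ R)
adjacentSwap-++ [] x y R = here x y R
adjacentSwap-++ (p ∷ P) x y R = there p (adjacentSwap-++ P x y R)

adjacentSwap-length : ∀ {L L′} → AdjacentSwap L L′ → length L ≡ length L′
adjacentSwap-length (here x y L) = refl
adjacentSwap-length (there p s) = cong suc (adjacentSwap-length s)

expand-swap : ∀ f g {L L′} → (∀ {l l′} → length l < length L → AdjacentSwap l l′ → g l ≡ - g l′) →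
  AdjacentSwap L L′ → expand f g L ≡ - expand f g L′
expand-swap f g g-swap (here x y R) = begin
  expand f g (x ∷ y ∷ R)
    ≡⟨ expand-∷ f g x (y ∷ R) ⟩
  f x * g (y ∷ R) - expand f (λ es → g (x ∷ es)) (y ∷ R)
    ≡⟨ cong (λ t → f x * g (y ∷ R) - t) (expand-∷ f _ y R) ⟩
  f x * g (y ∷ R) - (f y * g (x ∷ R) - T)
    ≡⟨ cong (λ t → f x * g (y ∷ R) - (f y * g (x ∷ R) - t)) T≡-T′ ⟩
  f x * g (y ∷ R) - (f y * g (x ∷ R) - - T′)
    ≡⟨ solve 5 (λ a b c d t → a :* b :- (c :* d :- :- t) := :- (c :* d :- (a :* b :- t)))
             refl (f x) (g (y ∷ R)) (f y) (g (x ∷ R)) T′ ⟩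
  - (f y * g (x ∷ R) - (f x * g (y ∷ R) - T′))
    ≡⟨ cong (λ t → - (f y * g (x ∷ R) - t)) (expand-∷ f _ x R) ⟨
  - (f y * g (x ∷ R) - expand f (λ es → g (y ∷ es)) (x ∷ R))
    ≡⟨ cong -_ (expand-∷ f g y (x ∷ R)) ⟨
  - expand f g (y ∷ x ∷ R) ∎
  where
  T  = expand f (λ es → g (x ∷ y ∷ es)) R
  T′ = expand f (λ es → g (y ∷ x ∷ es)) R
  T≡-T′ : T ≡ - T′
  T≡-T′ = trans (expand-congʳ f R (λ es lt → g-swap (s≤s (s≤s lt)) (here x y es))) (expand-negʳ f _ R)
expand-swap f g g-swap (there p {L} {L′} s) = begin
  expand f g (p ∷ L)                               ≡⟨ expand-∷ f g p L ⟩
  f p * g L - expand f (λ es → g (p ∷ es)) L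
    ≡⟨ cong₂ (λ u v → f p * u - v) (g-swap ℕ.≤-refl s)
             (expand-swap f _ (λ lt s′ → g-swap (s≤s lt) (there p s′)) s) ⟩
  f p * - g L′ - - expand f (λ es → g (p ∷ es)) L′
    ≡⟨ solve 3 (λ a b c → a :* :- b :- :- c := :- (a :* b :- c)) refl (f p) (g L′) _ ⟩
  - (f p * g L′ - expand f (λ es → g (p ∷ es)) L′) ≡⟨ cong -_ (expand-∷ f g p L′) ⟨
  - expand f g (p ∷ L′)                            ∎

detF-swap : ∀ k z r {L L′} → length L ≤ k → AdjacentSwap L L′ → detF k z r L ≡ - detF k z r L′
detF-swap zero z r () (here x y L)
detF-swap zero z r () (there p s)
detF-swap (suc k) z r L≤k s =
  expand-swap (z r) (detF k z (suc r)) (λ lt s′ → detF-swap k z (suc r) (ℕ.≤-pred (ℕ.≤-trans lt L≤k)) s′) s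

x≡-x⇒x≡0 : ∀ x → x ≡ - x → x ≡ 0ℚ
x≡-x⇒x≡0 x x≡-x = begin
  x             ≡⟨ solve 1 (λ x → x := con ½ :* (x :+ x)) refl x ⟩
  ½ * (x + x)   ≡⟨ cong (λ t → ½ * (x + t)) x≡-x ⟩
  ½ * (x + - x) ≡⟨ solve 1 (λ x → con ½ :* (x :+ :- x) := con 0ℚ) refl x ⟩
  0ℚ            ∎

detF-repeatedColumn : ∀ k z r P x M R → length (P ++ x ∷ M ++ x ∷ R) ≤ k → detF k z r (P ++ x ∷ M ++ x ∷ R) ≡ 0ℚ
detF-repeatedColumn k z r P x [] R L≤k = x≡-x⇒x≡0 _ (detF-swap k z r L≤k (adjacentSwap-++ P x x R))
detF-repeatedColumn k z r P x (m ∷ M) R L≤k = begin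
  detF k z r (P ++ x ∷ m ∷ M ++ x ∷ R)     ≡⟨ detF-swap k z r L≤k s ⟩
  - detF k z r (P ++ m ∷ x ∷ M ++ x ∷ R)   ≡⟨ cong (λ l → - detF k z r l) (++-assoc P (m ∷ []) _) ⟨
  - detF k z r ((P ++ m ∷ []) ++ x ∷ M ++ x ∷ R)
    ≡⟨ cong -_ (detF-repeatedColumn k z r (P ++ m ∷ []) x M R L′≤k) ⟩
  - 0ℚ                                     ∎
  where
  s = adjacentSwap-++ P x m (M ++ x ∷ R)
  L′≤k = subst (_≤ k) (trans (adjacentSwap-length s) (cong length (sym (++-assoc P (m ∷ []) _)))) L≤k

detF-repeated : ∀ k z r P x R → x ∈ P ++ R → length (P ++ x ∷ R) ≤ k → detF k z r (P ++ x ∷ R) ≡ 0ℚ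
detF-repeated k z r P x R x∈ L≤k with ∈-++⁻ P x∈
... | inj₂ x∈R with R₁ , R₂ , refl ← ∈-∃++ x∈R = detF-repeatedColumn k z r P x R₁ R₂ L≤k
... | inj₁ x∈P with P₁ , P₂ , refl ← ∈-∃++ x∈P =
  trans (cong (detF k z r) assoc) (detF-repeatedColumn k z r P₁ x P₂ R (subst (_≤ k) (cong length assoc) L≤k))
  where assoc = ++-assoc P₁ (x ∷ P₂) (x ∷ R)

expand-expand-∷ : ∀ u v g c L →
  expand u (λ ds → expand v g (c ∷ ds)) L ≡ v c * expand u g L - expand u (λ ds → expand v (λ es → g (c ∷ es)) ds) L
expand-expand-∷ u v g c L = trans (expand-congʳ u L (λ ds _ → expand-∷ v g c ds)) (expand-linearʳ u (v c) g _ L)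

expand-anticomm : ∀ u v g L → expand u (expand v g) L ≡ - expand v (expand u g) L
expand-anticomm u v g [] = refl
expand-anticomm u v g (c ∷ L) = begin
  expand u (expand v g) (c ∷ L)
    ≡⟨ expand-∷ u _ c L ⟩
  u c * expand v g L - expand u (λ ds → expand v g (c ∷ ds)) L
    ≡⟨ cong (λ t → u c * expand v g L - t) (expand-expand-∷ u v g c L) ⟩
  u c * expand v g L - (v c * expand u g L - X)
    ≡⟨ cong (λ t → u c * expand v g L - (v c * expand u g L - t)) (expand-anticomm u v _ L) ⟩
  u c * expand v g L - (v c * expand u g L - - Y)
    ≡⟨ solve 5 (λ a b c d y → a :* b :- (c :* d :- :- y) := :- (c :* d :- (a :* b :- y)))
             refl (u c) (expand v g L) (v c) (expand u g L) Y ⟩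
  - (v c * expand u g L - (u c * expand v g L - Y))
    ≡⟨ cong (λ t → - (v c * expand u g L - t)) (expand-expand-∷ v u g c L) ⟨
  - (v c * expand u g L - expand v (λ ds → expand u g (c ∷ ds)) L)
    ≡⟨ cong -_ (expand-∷ v _ c L) ⟨
  - expand v (expand u g) (c ∷ L) ∎
  where
  X = expand u (expand v (λ es → g (c ∷ es))) L
  Y = expand v (expand u (λ es → g (c ∷ es))) L

detF-repeatedRow : ∀ k z r i ys → r < i → i ≤ r ℕ.+ k → expand (z i) (detF k z (suc r)) ys ≡ 0ℚ
detF-repeatedRow zero z r i ys r<i i≤r+0 = ⊥-elim (ℕ.<⇒≱ r<i (subst (i ≤_) (ℕ.+-identityʳ r) i≤r+0))
detF-repeatedRow (suc k) z r i ys r<i i≤r+1+k with i ℕ.≟ suc r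
... | yes refl = x≡-x⇒x≡0 _ (expand-anticomm (z i) (z i) _ ys)
... | no i≢1+r = begin
  expand (z i) (expand (z (suc r)) G) ys
    ≡⟨ expand-anticomm (z i) (z (suc r)) G ys ⟩
  - expand (z (suc r)) (expand (z i) G) ys
    ≡⟨ cong -_ (expand-congʳ (z (suc r)) ys (λ ds _ → detF-repeatedRow k z (suc r) i ds 1+r<i i≤1+r+k)) ⟩
  - expand (z (suc r)) (λ _ → 0ℚ) ys
    ≡⟨ cong -_ (expand-zeroʳ (z (suc r)) ys) ⟩
  0ℚ ∎
  where
  G = detF k z (suc (suc r))
  1+r<i = ℕ.≤∧≢⇒< r<i (i≢1+r ∘ sym)
  i≤1+r+k = subst (i ≤_) (ℕ.+-suc r k) i≤r+1+k

-- The Grassmann–Plücker relations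

m+1+n≰0 : ∀ m {n} → ¬ (m ℕ.+ suc n ≤ 0)
m+1+n≰0 m {n} le with subst (_≤ 0) (ℕ.+-suc m n) le
... | ()

module _ (z : ℕ → ℕ → ℚ) (lo hi : ℕ) where

  data RowSpan : (ℕ → ℚ) → Set where
    row     : ∀ {i} → lo ≤ i → i < hi → RowSpan (z i)
    null    : RowSpan (λ _ → 0ℚ)
    lincomb : ∀ {φ ψ} c → RowSpan φ → RowSpan ψ → RowSpan (λ d → c * φ d - ψ d)
    pointwise : ∀ {φ ψ} → (∀ d → φ d ≡ ψ d) → RowSpan ψ → RowSpan φ

  ColumnsInRowSpan : (List ℕ → ℚ) → ℕ → Set
  ColumnsInRowSpan g m = ∀ Q R → length Q ℕ.+ suc (length R) ≤ m → RowSpan (λ d → g (Q ++ d ∷ R))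

  expand-rowSpan : ∀ f (G : List ℕ → ℕ → ℚ) L → (∀ es → length es < length L → RowSpan (G es)) →
    RowSpan (λ d → expand f (λ es → G es d) L)
  expand-rowSpan f G [] G∈ = null
  expand-rowSpan f G (c ∷ L) G∈ = pointwise (λ d → expand-∷ f (λ es → G es d) c L)
    (lincomb (f c) (G∈ L ℕ.≤-refl) (expand-rowSpan f (λ es → G (c ∷ es)) L (λ es lt → G∈ (c ∷ es) (s≤s lt))))

  expand-columnsInRowSpan : ∀ {r g m} → lo ≤ r → r < hi → ColumnsInRowSpan g m → ColumnsInRowSpan (expand (z r) g) (suc m)
  expand-columnsInRowSpan {r} {g} lo≤r r<hi g∈ [] R (s≤s R≤m) =
    pointwise (λ d → trans (expand-∷ (z r) g d R)
                             (cong (λ t → t - expand (z r) (λ es → g (d ∷ es)) R) (ℚ.*-comm (z r d) (g R))))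
      (lincomb (g R) (row lo≤r r<hi)
        (expand-rowSpan (z r) (λ es d → g (d ∷ es)) R (λ es lt → g∈ [] es (ℕ.≤-trans lt R≤m))))
  expand-columnsInRowSpan {m = zero} _ _ _ (p ∷ P) R (s≤s P+R<1) = ⊥-elim (m+1+n≰0 (length P) P+R<1)
  expand-columnsInRowSpan {r} {g} {suc m} lo≤r r<hi g∈ (p ∷ P) R (s≤s P+R<1+m) =
    pointwise (λ d → expand-∷ (z r) g p (P ++ d ∷ R))
      (lincomb (z r p) (g∈ P R P+R<1+m)
        (expand-columnsInRowSpan lo≤r r<hi (λ Q R′ lt → g∈ (p ∷ Q) R′ (s≤s lt)) P R P+R<1+m))

  detF-columnsInRowSpan : ∀ k r → lo ≤ r → r ℕ.+ k ≤ hi → ColumnsInRowSpan (detF k z r) k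
  detF-columnsInRowSpan zero r _ _ Q R Q+R<0 = ⊥-elim (m+1+n≰0 (length Q) Q+R<0)
  detF-columnsInRowSpan (suc k) r lo≤r r+k<hi =
    expand-columnsInRowSpan lo≤r (ℕ.<-≤-trans (ℕ.m<m+n r (s≤s z≤n)) r+k<hi)
      (detF-columnsInRowSpan k (suc r) (ℕ.m≤n⇒m≤1+n lo≤r) (subst (_≤ hi) (ℕ.+-suc r k) r+k<hi))

rowSpan-annihilates : ∀ k z r {φ} ys → RowSpan z (suc r) (suc r ℕ.+ k) φ → expand φ (detF k z (suc r)) ys ≡ 0ℚ
rowSpan-annihilates k z r ys (row r<i i<1+r+k) = detF-repeatedRow k z r _ ys r<i (ℕ.≤-pred i<1+r+k)
rowSpan-annihilates k z r ys null = expand-vanishingˡ (detF k z (suc r)) ys (All.universal (λ _ → refl) ys)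
rowSpan-annihilates k z r ys (lincomb {φ} {ψ} c φ∈ ψ∈) = begin
  expand (λ d → c * φ d - ψ d) G ys
    ≡⟨ expand-linearˡ c φ ψ G ys ⟩
  c * expand φ G ys - expand ψ G ys
    ≡⟨ cong₂ (λ u v → c * u - v) (rowSpan-annihilates k z r ys φ∈) (rowSpan-annihilates k z r ys ψ∈) ⟩
  c * 0ℚ - 0ℚ
    ≡⟨ solve 1 (λ c → c :* con 0ℚ :- con 0ℚ := con 0ℚ) refl c ⟩
  0ℚ ∎
  where G = detF k z (suc r)
rowSpan-annihilates k z r ys (pointwise φ≗ψ ψ∈) =
  trans (expand-congˡ (detF k z (suc r)) ys φ≗ψ) (rowSpan-annihilates k z r ys ψ∈)

-- d ↦ det (P ++ d ∷ R) is a combination of rows 1 … k, and a determinant whose extra top row is one of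
-- its other rows vanishes.
grassmannPlücker : ∀ k K z P R ys → length P ℕ.+ suc (length R) ≤ k → k ≤ K →
  expand (λ d → detF k z 1 (P ++ d ∷ R)) (detF K z 1) ys ≡ 0ℚ
grassmannPlücker k K z P R ys P+R<k k≤K =
  rowSpan-annihilates K z 0 ys (detF-columnsInRowSpan z 1 (1 ℕ.+ K) k 1 ℕ.≤-refl (s≤s k≤K) P R P+R<k)

expand-three : ∀ {φ} G A u v w C → All (λ d → φ d ≡ 0ℚ) A → All (λ d → φ d ≡ 0ℚ) C →
  expand φ G (A ++ u ∷ v ∷ w ∷ C) ≡
  sign (length A) * (φ u * G (A ++ v ∷ w ∷ C) - φ v * G (A ++ u ∷ w ∷ C) + φ w * G (A ++ u ∷ v ∷ C))
expand-three {φ} G A u v w C φA≡0 φC≡0 = begin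
  expand φ G (A ++ u ∷ v ∷ w ∷ C)
    ≡⟨ expand-++ φ G A _ ⟩
  expand φ _ A + sign (length A) * expand φ G′ (u ∷ v ∷ w ∷ C)
    ≡⟨ cong₂ (λ s t → s + sign (length A) * t) (expand-vanishingˡ _ A φA≡0) uvw ⟩
  0ℚ + sign (length A) * (φ u * G′ (v ∷ w ∷ C) - (φ v * G′ (u ∷ w ∷ C) - (φ w * G′ (u ∷ v ∷ C) - 0ℚ)))
    ≡⟨ solve 7 (λ s a b c d e f → con 0ℚ :+ s :* (a :* b :- (c :* d :- (e :* f :- con 0ℚ))) := s :* (a :* b :- c :* d :+ e :* f))
             refl (sign (length A)) (φ u) (G′ (v ∷ w ∷ C)) (φ v) (G′ (u ∷ w ∷ C)) (φ w) (G′ (u ∷ v ∷ C)) ⟩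
  sign (length A) * (φ u * G′ (v ∷ w ∷ C) - φ v * G′ (u ∷ w ∷ C) + φ w * G′ (u ∷ v ∷ C)) ∎
  where
  G′ = λ es → G (A ++ es)
  uvw : expand φ G′ (u ∷ v ∷ w ∷ C) ≡
        φ u * G′ (v ∷ w ∷ C) - (φ v * G′ (u ∷ w ∷ C) - (φ w * G′ (u ∷ v ∷ C) - 0ℚ))
  uvw = trans (expand-∷ φ G′ u _) (cong (λ t → φ u * G′ (v ∷ w ∷ C) - t)
          (trans (expand-∷ φ (λ es → G′ (u ∷ es)) v _) (cong (λ t → φ v * G′ (u ∷ w ∷ C) - t)
            (trans (expand-∷ φ (λ es → G′ (u ∷ v ∷ es)) w C)
              (cong (λ t → φ w * G′ (u ∷ v ∷ C) - t) (expand-vanishingˡ _ C φC≡0))))))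

threeTermPlücker : ∀ z A C α β γ δ →
  plucker z (A ++ α ∷ δ ∷ C) * plucker z (A ++ β ∷ γ ∷ C) - plucker z (A ++ α ∷ γ ∷ C) * plucker z (A ++ β ∷ δ ∷ C)
    + plucker z (A ++ α ∷ β ∷ C) * plucker z (A ++ γ ∷ δ ∷ C) ≡ 0ℚ
threeTermPlücker z A C α β γ δ = begin
  P α δ * P β γ - P α γ * P β δ + P α β * P γ δ
    ≡⟨ cong₂ _+_ (cong₂ _-_ (cong₂ _*_ (P≡M α δ) (P≡M β γ)) (cong₂ _*_ (P≡M α γ) (P≡M β δ)))
                 (cong₂ _*_ (P≡M α β) (P≡M γ δ)) ⟩
  M α δ * M β γ - M α γ * M β δ + M α β * M γ δ
    ≡⟨ solve 6 (λ a b c d e f → a :* b :- c :* d :+ e :* f := e :* f :- c :* d :+ a :* b)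
             refl (M α δ) (M β γ) (M α γ) (M β δ) (M α β) (M γ δ) ⟩
  M α β * M γ δ - M α γ * M β δ + M α δ * M β γ
    ≡⟨ sign-cancel (length A) (begin
      sign (length A) * (M α β * M γ δ - M α γ * M β δ + M α δ * M β γ)
        ≡⟨ expand-three (detF k z 1) A β γ δ C
             (All.tabulate (α-repeated ∘ ∈-++⁺ˡ ∘ ∈-++⁺ˡ)) (All.tabulate (α-repeated ∘ ∈-++⁺ʳ (A ++ α ∷ []))) ⟨
      expand (M α) (detF k z 1) (A ++ β ∷ γ ∷ δ ∷ C)
        ≡⟨ expand-congˡ (detF k z 1) (A ++ β ∷ γ ∷ δ ∷ C) (λ d → cong (detF k z 1) (++-assoc A (α ∷ []) (d ∷ C))) ⟨
      expand (λ d → detF k z 1 ((A ++ α ∷ []) ++ d ∷ C)) (detF k z 1) (A ++ β ∷ γ ∷ δ ∷ C)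
        ≡⟨ grassmannPlücker k k z (A ++ α ∷ []) C (A ++ β ∷ γ ∷ δ ∷ C) (ℕ.≤-reflexive Aα+C≡k) ℕ.≤-refl ⟩
      0ℚ ∎) ⟩
  0ℚ ∎
  where
  k = length A ℕ.+ suc (suc (length C))
  P : ℕ → ℕ → ℚ
  P u v = plucker z (A ++ u ∷ v ∷ C)
  M : ℕ → ℕ → ℚ
  M u v = detF k z 1 (A ++ u ∷ v ∷ C)
  P≡M : ∀ u v → P u v ≡ M u v
  P≡M u v = cong (λ l → detF l z 1 (A ++ u ∷ v ∷ C)) (length-++ A)
  Aα+C≡k : length (A ++ α ∷ []) ℕ.+ suc (length C) ≡ k
  Aα+C≡k = trans (cong (ℕ._+ suc (length C)) (length-++ A)) (ℕ.+-assoc (length A) 1 _)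
  α-repeated : ∀ {d} → d ∈ (A ++ α ∷ []) ++ C → M α d ≡ 0ℚ
  α-repeated {d} d∈ = trans (cong (detF k z 1) (sym (++-assoc A (α ∷ []) (d ∷ C))))
    (detF-repeated k z 1 (A ++ α ∷ []) d C d∈ (ℕ.≤-reflexive (trans (length-++ (A ++ α ∷ [])) Aα+C≡k)))

incidencePlücker : ∀ z A x y w →
  plucker z (A ++ y ∷ w ∷ []) * plucker z (A ++ x ∷ []) - plucker z (A ++ x ∷ w ∷ []) * plucker z (A ++ y ∷ [])
    + plucker z (A ++ x ∷ y ∷ []) * plucker z (A ++ w ∷ []) ≡ 0ℚ
incidencePlücker z A x y w = begin
  P₂ y w * P₁ x - P₂ x w * P₁ y + P₂ x y * P₁ w
    ≡⟨ cong₂ _+_ (cong₂ _-_ (cong₂ _*_ (P₂≡M₂ y w) (P₁≡M₁ x)) (cong₂ _*_ (P₂≡M₂ x w) (P₁≡M₁ y)))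
                 (cong₂ _*_ (P₂≡M₂ x y) (P₁≡M₁ w)) ⟩
  M₂ y w * M₁ x - M₂ x w * M₁ y + M₂ x y * M₁ w
    ≡⟨ solve 6 (λ a b c d e f → a :* b :- c :* d :+ e :* f := b :* a :- d :* c :+ f :* e)
             refl (M₂ y w) (M₁ x) (M₂ x w) (M₁ y) (M₂ x y) (M₁ w) ⟩
  M₁ x * M₂ y w - M₁ y * M₂ x w + M₁ w * M₂ x y
    ≡⟨ sign-cancel (length A) (begin
      sign (length A) * (M₁ x * M₂ y w - M₁ y * M₂ x w + M₁ w * M₂ x y)
        ≡⟨ expand-three (detF (length A ℕ.+ 2) z 1) A x y w [] (All.tabulate repeated) [] ⟨
      expand M₁ (detF (length A ℕ.+ 2) z 1) (A ++ x ∷ y ∷ w ∷ [])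
        ≡⟨ grassmannPlücker (length A ℕ.+ 1) (length A ℕ.+ 2) z A [] (A ++ x ∷ y ∷ w ∷ [])
             ℕ.≤-refl (ℕ.+-monoʳ-≤ (length A) (s≤s z≤n)) ⟩
      0ℚ ∎) ⟩
  0ℚ ∎
  where
  P₁ : ℕ → ℚ
  P₁ u = plucker z (A ++ u ∷ [])
  P₂ : ℕ → ℕ → ℚ
  P₂ u v = plucker z (A ++ u ∷ v ∷ [])
  M₁ : ℕ → ℚ
  M₁ u = detF (length A ℕ.+ 1) z 1 (A ++ u ∷ [])
  M₂ : ℕ → ℕ → ℚ
  M₂ u v = detF (length A ℕ.+ 2) z 1 (A ++ u ∷ v ∷ [])
  P₁≡M₁ : ∀ u → P₁ u ≡ M₁ u
  P₁≡M₁ u = cong (λ l → detF l z 1 (A ++ u ∷ [])) (length-++ A)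
  P₂≡M₂ : ∀ u v → P₂ u v ≡ M₂ u v
  P₂≡M₂ u v = cong (λ l → detF l z 1 (A ++ u ∷ v ∷ [])) (length-++ A)
  repeated : ∀ {d} → d ∈ A → M₁ d ≡ 0ℚ
  repeated {d} d∈A = detF-repeated _ z 1 A d [] (∈-++⁺ˡ d∈A) (ℕ.≤-reflexive (length-++ A))

inPluckerIdeal-threeTerm : ∀ {a b p q} →
  (∀ z → plucker z a * plucker z b - plucker z (meet a b) * plucker z (join a b) + plucker z p * plucker z q ≡ 0ℚ) →
  InPluckerIdeal a b (- 1ℚ) p q
inPluckerIdeal-threeTerm {a} {b} {p} {q} relation z =
  trans (solve 3 (λ x y w → (x :- y) :- con (- 1ℚ) :* w := x :- y :+ w)
               refl (P a * P b) (P (meet a b) * P (join a b)) (P p * P q))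
        (relation z)
  where P = plucker z

-- Torus weights

∏ : (ℕ → ℚ) → List ℕ → ℚ
∏ w [] = 1ℚ
∏ w (e ∷ L) = w e * ∏ w L

expand-scaleColumns : ∀ w f {g g′} L → (∀ es → length es < length L → g′ es ≡ ∏ w es * g es) →
  expand (λ e → w e * f e) g′ L ≡ ∏ w L * expand f g L
expand-scaleColumns w f [] g′≡ = sym (ℚ.*-zeroʳ 1ℚ)
expand-scaleColumns w f {g} {g′} (c ∷ L) g′≡ = begin
  expand (λ e → w e * f e) g′ (c ∷ L)
    ≡⟨ expand-∷ (λ e → w e * f e) g′ c L ⟩
  w c * f c * g′ L - expand (λ e → w e * f e) (λ es → g′ (c ∷ es)) L
    ≡⟨ cong₂ (λ u v → w c * f c * u - v) (g′≡ L ℕ.≤-refl)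
         (expand-congʳ wf L (λ es lt → trans (g′≡ (c ∷ es) (s≤s lt)) (ℚ.*-assoc (w c) (∏ w es) (g (c ∷ es))))) ⟩
  w c * f c * (∏ w L * g L) - expand (λ e → w e * f e) (λ es → w c * (∏ w es * g (c ∷ es))) L
    ≡⟨ cong (λ t → w c * f c * (∏ w L * g L) - t)
         (trans (expand-scaleʳ wf (w c) _ L) (cong (w c *_) (expand-scaleColumns w f L (λ es _ → refl)))) ⟩
  w c * f c * (∏ w L * g L) - w c * (∏ w L * expand f (λ es → g (c ∷ es)) L)
    ≡⟨ solve 5 (λ a b c d e → a :* b :* (c :* d) :- a :* (c :* e) := a :* c :* (b :* d :- e)) refl (w c) (f c) (∏ w L) (g L) _ ⟩
  w c * ∏ w L * (f c * g L - expand f (λ es → g (c ∷ es)) L)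
    ≡⟨ cong (w c * ∏ w L *_) (expand-∷ f g c L) ⟨
  w c * ∏ w L * expand f g (c ∷ L) ∎
  where wf = λ e → w e * f e

detF-scaleColumns : ∀ w k z r L → length L ≤ k → detF k (λ i e → w e * z i e) r L ≡ ∏ w L * detF k z r L
detF-scaleColumns w zero z r [] _ = sym (ℚ.*-identityˡ 1ℚ)
detF-scaleColumns w (suc k) z r L L≤1+k =
  expand-scaleColumns w (z r) L (λ es lt → detF-scaleColumns w k z (suc r) es (ℕ.≤-pred (ℕ.≤-trans lt L≤1+k)))

detF-scaleRows : ∀ ρ k z r L → detF k (λ i e → ρ i * z i e) r L ≡ ∏ ρ (iterate suc r k) * detF k z r L
detF-scaleRows ρ zero z r L = sym (ℚ.*-identityˡ 1ℚ)
detF-scaleRows ρ (suc k) z r L = begin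
  expand (λ e → ρ r * z r e) (detF k (λ i e → ρ i * z i e) (suc r)) L
    ≡⟨ expand-congʳ ρz L (λ es _ → detF-scaleRows ρ k z (suc r) es) ⟩
  expand (λ e → ρ r * z r e) (λ es → Π * detF k z (suc r) es) L
    ≡⟨ expand-scaleʳ ρz Π (detF k z (suc r)) L ⟩
  Π * expand (λ e → ρ r * z r e) (detF k z (suc r)) L
    ≡⟨ cong (Π *_) (expand-scaleˡ (ρ r) (z r) _ L) ⟩
  Π * (ρ r * expand (z r) (detF k z (suc r)) L)
    ≡⟨ solve 3 (λ a b c → a :* (b :* c) := b :* a :* c) refl Π (ρ r) _ ⟩
  ρ r * Π * detF (suc k) z r L ∎
  where
  Π = ∏ ρ (iterate suc (suc r) k)
  ρz = λ e → ρ r * z r e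

2ℚ : ℚ
2ℚ = 1ℚ + 1ℚ

pow2 : ℕ → ℚ
pow2 zero = 1ℚ
pow2 (suc n) = 2ℚ * pow2 n

pow2-+ : ∀ m n → pow2 m * pow2 n ≡ pow2 (m ℕ.+ n)
pow2-+ zero n = ℚ.*-identityˡ (pow2 n)
pow2-+ (suc m) n = trans (ℚ.*-assoc 2ℚ (pow2 m) (pow2 n)) (cong (2ℚ *_) (pow2-+ m n))

pow2-injective-≤2 : ∀ {m n} → m ≤ 2 → n ≤ 2 → pow2 m ≡ pow2 n → m ≡ n
pow2-injective-≤2 z≤n z≤n _ = refl
pow2-injective-≤2 (s≤s z≤n) (s≤s z≤n) _ = refl
pow2-injective-≤2 (s≤s (s≤s z≤n)) (s≤s (s≤s z≤n)) _ = refl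
pow2-injective-≤2 z≤n (s≤s z≤n) ()
pow2-injective-≤2 z≤n (s≤s (s≤s z≤n)) ()
pow2-injective-≤2 (s≤s z≤n) z≤n ()
pow2-injective-≤2 (s≤s z≤n) (s≤s (s≤s z≤n)) ()
pow2-injective-≤2 (s≤s (s≤s z≤n)) z≤n ()
pow2-injective-≤2 (s≤s (s≤s z≤n)) (s≤s z≤n) ()

δ : ℕ → ℕ → ℕ
δ zero zero = 1
δ zero (suc n) = 0
δ (suc m) zero = 0
δ (suc m) (suc n) = δ m n

δ-refl : ∀ n → δ n n ≡ 1
δ-refl zero = refl
δ-refl (suc n) = δ-refl n

δ-≢ : ∀ {m n} → m ≢ n → δ m n ≡ 0
δ-≢ {zero} {zero} m≢n = ⊥-elim (m≢n refl)
δ-≢ {zero} {suc n} _ = refl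
δ-≢ {suc m} {zero} _ = refl
δ-≢ {suc m} {suc n} m≢n = δ-≢ (m≢n ∘ cong suc)

count : ℕ → List ℕ → ℕ
count d [] = 0
count d (e ∷ L) = δ e d ℕ.+ count d L

doubleAt : ℕ → ℕ → ℚ
doubleAt d e = pow2 (δ e d)

∏-doubleAt : ∀ d L → ∏ (doubleAt d) L ≡ pow2 (count d L)
∏-doubleAt d [] = refl
∏-doubleAt d (e ∷ L) = trans (cong (doubleAt d e *_) (∏-doubleAt d L)) (pow2-+ (δ e d) (count d L))

count-++ : ∀ d X Y → count d (X ++ Y) ≡ count d X ℕ.+ count d Y
count-++ d [] Y = refl
count-++ d (e ∷ X) Y = trans (cong (δ e d ℕ.+_) (count-++ d X Y)) (sym (ℕ.+-assoc (δ e d) _ _))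

count-∉ : ∀ {d L} → d ∉ L → count d L ≡ 0
count-∉ {d} {[]} _ = refl
count-∉ {d} {e ∷ L} d∉ = cong₂ ℕ._+_ (δ-≢ (d∉ ∘ here ∘ sym)) (count-∉ (d∉ ∘ there))

count-∈ : ∀ {d L} → d ∈ L → 1 ≤ count d L
count-∈ {d} {e ∷ L} (here refl) = subst (λ t → 1 ≤ t ℕ.+ count d L) (sym (δ-refl d)) (s≤s z≤n)
count-∈ {d} {e ∷ L} (there d∈) = ℕ.≤-trans (count-∈ d∈) (ℕ.m≤n+m (count d L) (δ e d))

1≤count⇒∈ : ∀ {d} L → 1 ≤ count d L → d ∈ L
1≤count⇒∈ {d} (e ∷ L) 1≤ with e ℕ.≟ d
... | yes refl = here refl
... | no e≢d = there (1≤count⇒∈ L (subst (λ t → 1 ≤ t ℕ.+ count d L) (δ-≢ e≢d) 1≤))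

count-≤1 : ∀ {d L} → AllPairs _<_ L → count d L ≤ 1
count-≤1 [] = z≤n
count-≤1 {d} {e ∷ L} (e<L ∷ sorted) with e ℕ.≟ d
... | yes refl = ℕ.≤-reflexive (cong₂ ℕ._+_ (δ-refl e) (count-∉ (All¬⇒¬Any (All.map ℕ.<⇒≢ e<L))))
... | no e≢d = subst (λ t → t ℕ.+ count d L ≤ 1) (sym (δ-≢ e≢d)) (count-≤1 sorted)

iterate-suc-lowerBound : ∀ r k → All (r ≤_) (iterate suc r k)
iterate-suc-lowerBound r zero = []
iterate-suc-lowerBound r (suc k) = ℕ.≤-refl ∷ All.map (ℕ.≤-trans (ℕ.n≤1+n r)) (iterate-suc-lowerBound (suc r) k)

iterate-suc-increasing : ∀ r k → AllPairs _<_ (iterate suc r k)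
iterate-suc-increasing r zero = []
iterate-suc-increasing r (suc k) = iterate-suc-lowerBound (suc r) k ∷ iterate-suc-increasing (suc r) k

count-iterate-suc-below : ∀ {R r} k → R < r → count R (iterate suc r k) ≡ 0
count-iterate-suc-below zero R<r = refl
count-iterate-suc-below {R} {r} (suc k) R<r =
  cong₂ ℕ._+_ (δ-≢ (ℕ.<⇒≢ R<r ∘ sym)) (count-iterate-suc-below k (ℕ.m≤n⇒m≤1+n R<r))

count-iterate-suc-above : ∀ {R r} k → r ℕ.+ k ≤ R → count R (iterate suc r k) ≡ 0
count-iterate-suc-above zero _ = refl
count-iterate-suc-above {R} {r} (suc k) r+1+k≤R =
  cong₂ ℕ._+_ (δ-≢ (ℕ.<⇒≢ (ℕ.<-≤-trans (ℕ.m<m+n r (s≤s z≤n)) r+1+k≤R)))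
              (count-iterate-suc-above k (subst (_≤ R) (ℕ.+-suc r k) r+1+k≤R))

count-iterate-suc-inside : ∀ {R r} k → r ≤ R → R < r ℕ.+ k → count R (iterate suc r k) ≡ 1
count-iterate-suc-inside {R} {r} zero r≤R R<r+0 = ⊥-elim (ℕ.<⇒≱ (subst (R <_) (ℕ.+-identityʳ r) R<r+0) r≤R)
count-iterate-suc-inside {R} {r} (suc k) r≤R R<r+1+k with r ℕ.≟ R
... | yes refl = cong₂ ℕ._+_ (δ-refl r) (count-iterate-suc-below k ℕ.≤-refl)
... | no r≢R =
  cong₂ ℕ._+_ (δ-≢ r≢R) (count-iterate-suc-inside k (ℕ.≤∧≢⇒< r≤R r≢R) (subst (R <_) (ℕ.+-suc r k) R<r+1+k))

rowCount : ℕ → ℕ → ℕ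
rowCount k R = count R (iterate suc 1 k)

rowCount-≤1 : ∀ k R → rowCount k R ≤ 1
rowCount-≤1 k R = count-≤1 (iterate-suc-increasing 1 k)

rowCount-inside : ∀ {k R} → 1 ≤ R → R ≤ k → rowCount k R ≡ 1
rowCount-inside {k} 1≤R R≤k = count-iterate-suc-inside k 1≤R (s≤s R≤k)

rowCount-above : ∀ {k R} → k < R → rowCount k R ≡ 0
rowCount-above {k} k<R = count-iterate-suc-above k k<R

rowCount≡1⇒≤ : ∀ {k R} → rowCount k R ≡ 1 → R ≤ k
rowCount≡1⇒≤ {k} {R} count≡1 with R ℕ.≤? k
... | yes R≤k = R≤k
... | no R≰k with () ← trans (sym (rowCount-above (ℕ.≰⇒> R≰k))) count≡1

rowCount≡0⇒< : ∀ {k R} → 1 ≤ R → rowCount k R ≡ 0 → k < R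
rowCount≡0⇒< {k} {R} 1≤R count≡0 with R ℕ.≤? k
... | yes R≤k with () ← trans (sym (rowCount-inside 1≤R R≤k)) count≡0
... | no R≰k = ℕ.≰⇒> R≰k

m+n≡2⇒m≡1∧n≡1 : ∀ {m n} → m ≤ 1 → n ≤ 1 → m ℕ.+ n ≡ 2 → m ≡ 1 × n ≡ 1
m+n≡2⇒m≡1∧n≡1 (s≤s z≤n) (s≤s z≤n) _ = refl , refl
m+n≡2⇒m≡1∧n≡1 z≤n z≤n ()
m+n≡2⇒m≡1∧n≡1 z≤n (s≤s z≤n) ()
m+n≡2⇒m≡1∧n≡1 (s≤s z≤n) z≤n ()

m+n≤1⇒m≡0∨n≡0 : ∀ m {n} → m ℕ.+ n ≤ 1 → m ≡ 0 ⊎ n ≡ 0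
m+n≤1⇒m≡0∨n≡0 zero _ = inj₁ refl
m+n≤1⇒m≡0∨n≡0 (suc m) (s≤s m+n≤0) = inj₂ (ℕ.n≤0⇒n≡0 (ℕ.m+n≤o⇒n≤o m m+n≤0))

rowCounts⇒length : ∀ {a′ b′ p′ q′} →
  (∀ R → rowCount a′ R ℕ.+ rowCount b′ R ≡ rowCount p′ R ℕ.+ rowCount q′ R) →
  1 ≤ q′ → q′ ≤ p′ → q′ ≡ a′ ⊓ b′
rowCounts⇒length {a′} {b′} {p′} {q′} balance 1≤q′ q′≤p′ =
  ℕ.≤-antisym (ℕ.⊓-glb (rowCount≡1⇒≤ (proj₁ both)) (rowCount≡1⇒≤ (proj₂ both))) a′⊓b′≤q′
  where
  both : rowCount a′ q′ ≡ 1 × rowCount b′ q′ ≡ 1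
  both = m+n≡2⇒m≡1∧n≡1 (rowCount-≤1 a′ q′) (rowCount-≤1 b′ q′)
    (trans (balance q′) (cong₂ ℕ._+_ (rowCount-inside 1≤q′ q′≤p′) (rowCount-inside 1≤q′ ℕ.≤-refl)))
  after-q′ : rowCount a′ (suc q′) ℕ.+ rowCount b′ (suc q′) ≤ 1
  after-q′ = subst (_≤ 1)
    (sym (trans (balance (suc q′)) (cong (rowCount p′ (suc q′) ℕ.+_) (rowCount-above {q′} ℕ.≤-refl))))
    (ℕ.≤-trans (ℕ.≤-reflexive (ℕ.+-identityʳ _)) (rowCount-≤1 p′ (suc q′)))
  a′⊓b′≤q′ : a′ ⊓ b′ ≤ q′
  a′⊓b′≤q′ with m+n≤1⇒m≡0∨n≡0 (rowCount a′ (suc q′)) after-q′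
  ... | inj₁ a′-count≡0 = ℕ.≤-trans (ℕ.m⊓n≤m a′ b′) (ℕ.≤-pred (rowCount≡0⇒< (s≤s z≤n) a′-count≡0))
  ... | inj₂ b′-count≡0 = ℕ.≤-trans (ℕ.m⊓n≤n a′ b′) (ℕ.≤-pred (rowCount≡0⇒< (s≤s z≤n) b′-count≡0))

x*y≡0⇒y≢0⇒x≡0 : ∀ x y → x * y ≡ 0ℚ → y ≢ 0ℚ → x ≡ 0ℚ
x*y≡0⇒y≢0⇒x≡0 x y xy≡0 y≢0 = begin
  x             ≡⟨ ℚ.*-identityʳ x ⟨
  x * 1ℚ        ≡⟨ cong (x *_) (ℚ.*-inverseʳ y) ⟨
  x * (y * y⁻¹) ≡⟨ ℚ.*-assoc x y y⁻¹ ⟨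
  x * y * y⁻¹   ≡⟨ cong (_* y⁻¹) xy≡0 ⟩
  0ℚ * y⁻¹      ≡⟨ ℚ.*-zeroˡ y⁻¹ ⟩
  0ℚ            ∎
  where
  instance _ = ≢-nonZero y≢0
  y⁻¹ = 1/ y

Separates : (ℕ → ℕ → ℚ) → List ℕ → List ℕ → Set
Separates z a b = plucker z (meet a b) * plucker z (join a b) ≡ 0ℚ × plucker z a * plucker z b ≢ 0ℚ

weight-balance : ∀ {a b c p q z z′} (w : List ℕ → ℚ) → InPluckerIdeal a b c p q → Separates z a b →
  (∀ x → plucker z′ x ≡ w x * plucker z x) → w a * w b ≡ w p * w q
weight-balance {a} {b} {c} {p} {q} {z} {z′} w I (PmPj≡0 , PaPb≢0) scaled =
  trans (solve 2 (λ x y → x := (x :- y) :+ y) refl (w a * w b) (w p * w q))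
        (trans (cong (_+ w p * w q) (x*y≡0⇒y≢0⇒x≡0 (w a * w b - w p * w q) (P a * P b) difference≡0 PaPb≢0))
               (ℚ.+-identityˡ (w p * w q)))
  where
  m = meet a b
  j = join a b
  P = plucker z
  relation′ : (w a * P a * (w b * P b) - w m * P m * (w j * P j)) - c * (w p * P p * (w q * P q)) ≡ 0ℚ
  relation′ = subst (λ t → t ≡ 0ℚ)
    (cong₂ (λ u v → u - c * v) (cong₂ (λ u v → u - v) (cong₂ _*_ (scaled a) (scaled b)) (cong₂ _*_ (scaled m) (scaled j)))
      (cong₂ _*_ (scaled p) (scaled q)))
    (I z′)
  difference≡0 : (w a * w b - w p * w q) * (P a * P b) ≡ 0ℚ
  difference≡0 = begin
    (w a * w b - w p * w q) * (P a * P b)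
      ≡⟨ solve 13 (λ la lb lm lj lp lq pa pb pm pj pp pq c →
            (la :* lb :- lp :* lq) :* (pa :* pb) :=
            ((la :* pa :* (lb :* pb) :- lm :* pm :* (lj :* pj)) :- c :* (lp :* pp :* (lq :* pq)))
            :- lp :* lq :* ((pa :* pb :- pm :* pj) :- c :* (pp :* pq)) :+ (lm :* lj :- lp :* lq) :* (pm :* pj))
          refl (w a) (w b) (w m) (w j) (w p) (w q) (P a) (P b) (P m) (P j) (P p) (P q) c ⟩
    ((w a * P a * (w b * P b) - w m * P m * (w j * P j)) - c * (w p * P p * (w q * P q)))
      - w p * w q * ((P a * P b - P m * P j) - c * (P p * P q)) + (w m * w j - w p * w q) * (P m * P j)
      ≡⟨ cong₂ (λ s t → s - w p * w q * t + (w m * w j - w p * w q) * (P m * P j)) relation′ (I z) ⟩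
    0ℚ - w p * w q * 0ℚ + (w m * w j - w p * w q) * (P m * P j)
      ≡⟨ cong (λ t → 0ℚ - w p * w q * 0ℚ + (w m * w j - w p * w q) * t) PmPj≡0 ⟩
    0ℚ - w p * w q * 0ℚ + (w m * w j - w p * w q) * 0ℚ
      ≡⟨ solve 2 (λ x y → con 0ℚ :- x :* con 0ℚ :+ y :* con 0ℚ := con 0ℚ) refl (w p * w q) (w m * w j - w p * w q) ⟩
    0ℚ ∎

exponent-balance : ∀ {a b c p q z z′} (F : List ℕ → ℕ) → InPluckerIdeal a b c p q → Separates z a b →
  (∀ x → plucker z′ x ≡ pow2 (F x) * plucker z x) → F a ≤ 1 → F b ≤ 1 → F p ≤ 1 → F q ≤ 1 →
  F a ℕ.+ F b ≡ F p ℕ.+ F q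
exponent-balance {a} {b} {c} {p} {q} F I sep scaled Fa≤1 Fb≤1 Fp≤1 Fq≤1 =
  pow2-injective-≤2 (ℕ.+-mono-≤ Fa≤1 Fb≤1) (ℕ.+-mono-≤ Fp≤1 Fq≤1)
    (trans (sym (pow2-+ (F a) (F b))) (trans (weight-balance {c = c} (pow2 ∘ F) I sep scaled) (pow2-+ (F p) (F q))))

module _ {a b c p q z} (I : InPluckerIdeal a b c p q) (sep : Separates z a b) where

  column-balance : AllPairs _<_ a → AllPairs _<_ b → AllPairs _<_ p → AllPairs _<_ q →
    ∀ d → count d a ℕ.+ count d b ≡ count d p ℕ.+ count d q
  column-balance a↑ b↑ p↑ q↑ d = exponent-balance {a} {b} {c} {p} {q} (count d) I sep
    (λ x → trans (detF-scaleColumns (doubleAt d) (length x) z 1 x ℕ.≤-refl) (cong (_* plucker z x) (∏-doubleAt d x)))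
    (count-≤1 a↑) (count-≤1 b↑) (count-≤1 p↑) (count-≤1 q↑)

  row-balance : ∀ R → rowCount (length a) R ℕ.+ rowCount (length b) R ≡ rowCount (length p) R ℕ.+ rowCount (length q) R
  row-balance R = exponent-balance {a} {b} {c} {p} {q} (λ x → rowCount (length x) R) I sep
    (λ x → trans (detF-scaleRows (doubleAt R) (length x) z 1 x) (cong (_* plucker z x) (∏-doubleAt R (iterate suc 1 (length x)))))
    (rowCount-≤1 (length a) R) (rowCount-≤1 (length b) R) (rowCount-≤1 (length p) R) (rowCount-≤1 (length q) R)

increasing : ∀ {n x} → Valid n x → AllPairs _<_ x
increasing (_ , _ , _ , x↑) = Linked⇒AllPairs ℕ.<-trans x↑

linked-tail : ∀ {x L} → Linked _<_ (x ∷ L) → Linked _<_ L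
linked-tail [-] = []
linked-tail (_ ∷ L↑) = L↑

linked-lower : ∀ {x y L} → Linked _<_ (y ∷ L) → x ≤ y → Linked _<_ (x ∷ L)
linked-lower [-] _ = [-]
linked-lower (y<z ∷ L↑) x≤y = ℕ.≤-<-trans x≤y y<z ∷ L↑

linked-cons-raise : ∀ {x} U {x′ V} → Linked _<_ (x ∷ U ++ x′ ∷ V) → Linked _<_ (U ++ suc x′ ∷ V) →
  Linked _<_ (x ∷ U ++ suc x′ ∷ V)
linked-cons-raise [] (x<x′ ∷ _) raised↑ = ℕ.<-trans x<x′ (ℕ.n<1+n _) ∷ raised↑
linked-cons-raise (u ∷ U) (x<u ∷ _) raised↑ = x<u ∷ raised↑

linked-split : ∀ P {x L} → Linked _<_ (P ++ x ∷ L) → Linked _<_ (P ++ x ∷ []) × Linked _<_ (x ∷ L)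
linked-split [] x↑ = [-] , x↑
linked-split (p ∷ []) (p<x ∷ x↑) = p<x ∷ [-] , x↑
linked-split (p ∷ p′ ∷ P) (p<p′ ∷ P↑) = map₁ (p<p′ ∷_) (linked-split (p′ ∷ P) P↑)

linked-join : ∀ P {x L} → Linked _<_ (P ++ x ∷ []) → Linked _<_ (x ∷ L) → Linked _<_ (P ++ x ∷ L)
linked-join [] _ x↑ = x↑
linked-join (p ∷ []) (p<x ∷ _) x↑ = p<x ∷ x↑
linked-join (p ∷ p′ ∷ P) (p<p′ ∷ P↑) x↑ = p<p′ ∷ linked-join (p′ ∷ P) P↑ x↑

linked-raiseLast : ∀ P {x y} → Linked _<_ (P ++ x ∷ []) → x ≤ y → Linked _<_ (P ++ y ∷ [])
linked-raiseLast [] _ _ = [-]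
linked-raiseLast (p ∷ []) (p<x ∷ [-]) x≤y = ℕ.<-≤-trans p<x x≤y ∷ [-]
linked-raiseLast (p ∷ p′ ∷ P) (p<p′ ∷ P↑) x≤y = p<p′ ∷ linked-raiseLast (p′ ∷ P) P↑ x≤y

allPairs-dropPrefix : ∀ {R : ℕ → ℕ → Set} A {L} → AllPairs R (A ++ L) → AllPairs R L
allPairs-dropPrefix [] AL↑ = AL↑
allPairs-dropPrefix (a ∷ A) (_ ∷ AL↑) = allPairs-dropPrefix A AL↑

allPairs-beforeMiddle : ∀ {R : ℕ → ℕ → Set} B {v C} → AllPairs R (B ++ v ∷ C) → All (λ b → R b v) B
allPairs-beforeMiddle [] _ = []
allPairs-beforeMiddle (b ∷ B) (b<BvC ∷ BvC↑) = All.head (++⁻ʳ B b<BvC) ∷ allPairs-beforeMiddle B BvC↑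

allPairs-deleteMiddle : ∀ {R : ℕ → ℕ → Set} B {v C} → AllPairs R (B ++ v ∷ C) → AllPairs R (B ++ C)
allPairs-deleteMiddle [] (_ ∷ C↑) = C↑
allPairs-deleteMiddle (b ∷ B) (b<BvC ∷ BvC↑) = ++⁺ (++⁻ˡ B b<BvC) (All.tail (++⁻ʳ B b<BvC)) ∷ allPairs-deleteMiddle B BvC↑

-- The lattice

≼-refl : ∀ L → L ≼ L
≼-refl [] = tt
≼-refl (x ∷ L) = ℕ.≤-refl , ≼-refl L

≼-++ : ∀ A {L L′} → L ≼ L′ → (A ++ L) ≼ (A ++ L′)
≼-++ [] L≼L′ = L≼L′
≼-++ (a ∷ A) L≼L′ = ℕ.≤-refl , ≼-++ A L≼L′

≼-length : ∀ {x y} → x ≼ y → length y ≤ length x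
≼-length {x} {[]} _ = z≤n
≼-length {x ∷ xs} {y ∷ ys} (_ , xs≼ys) = s≤s (≼-length xs≼ys)

≼-antisym : ∀ {x y} → x ≼ y → y ≼ x → x ≡ y
≼-antisym {[]} {[]} _ _ = refl
≼-antisym {x ∷ xs} {y ∷ ys} (x≤y , xs≼ys) (y≤x , ys≼xs) =
  cong₂ _∷_ (ℕ.≤-antisym x≤y y≤x) (≼-antisym xs≼ys ys≼xs)

length-join : ∀ a b → length (join a b) ≡ length a ⊓ length b
length-join [] b = refl
length-join (x ∷ a) [] = refl
length-join (x ∷ a) (y ∷ b) = cong suc (length-join a b)

meet-++ : ∀ A L L′ → meet (A ++ L) (A ++ L′) ≡ A ++ meet L L′
meet-++ [] L L′ = refl
meet-++ (a ∷ A) L L′ = cong₂ _∷_ (ℕ.⊓-idem a) (meet-++ A L L′)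

join-++ : ∀ A L L′ → join (A ++ L) (A ++ L′) ≡ A ++ join L L′
join-++ [] L L′ = refl
join-++ (a ∷ A) L L′ = cong₂ _∷_ (ℕ.⊔-idem a) (join-++ A L L′)

meet-idem : ∀ L → meet L L ≡ L
meet-idem [] = refl
meet-idem (x ∷ L) = cong₂ _∷_ (ℕ.⊓-idem x) (meet-idem L)

join-idem : ∀ L → join L L ≡ L
join-idem [] = refl
join-idem (x ∷ L) = cong₂ _∷_ (ℕ.⊔-idem x) (join-idem L)

meet-extension : ∀ B C → meet (B ++ C) B ≡ B ++ C
meet-extension [] [] = refl
meet-extension [] (c ∷ C) = refl
meet-extension (b ∷ B) C = cong₂ _∷_ (ℕ.⊓-idem b) (meet-extension B C)

join-extension : ∀ B C → join (B ++ C) B ≡ B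
join-extension [] [] = refl
join-extension [] (c ∷ C) = refl
join-extension (b ∷ B) C = cong₂ _∷_ (ℕ.⊔-idem b) (join-extension B C)

module _ (A B C : List ℕ) (α γ : ℕ) where

  meet-case1 : meet (A ++ α ∷ B ++ suc γ ∷ C) (A ++ suc α ∷ B ++ γ ∷ C) ≡ A ++ α ∷ B ++ γ ∷ C
  meet-case1 = trans (meet-++ A _ _) (cong (A ++_) (cong₂ _∷_ (ℕ.m≤n⇒m⊓n≡m (ℕ.n≤1+n α))
    (trans (meet-++ B _ _) (cong (B ++_) (cong₂ _∷_ (ℕ.m≥n⇒m⊓n≡n (ℕ.n≤1+n γ)) (meet-idem C))))))

  join-case1 : join (A ++ α ∷ B ++ suc γ ∷ C) (A ++ suc α ∷ B ++ γ ∷ C) ≡ A ++ suc α ∷ B ++ suc γ ∷ C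
  join-case1 = trans (join-++ A _ _) (cong (A ++_) (cong₂ _∷_ (ℕ.m≤n⇒m⊔n≡n (ℕ.n≤1+n α))
    (trans (join-++ B _ _) (cong (B ++_) (cong₂ _∷_ (ℕ.m≥n⇒m⊔n≡m (ℕ.n≤1+n γ)) (join-idem C))))))

module _ (A B : List ℕ) (β n : ℕ) where

  meet-case2 : meet (A ++ suc β ∷ B ++ n ∷ []) (A ++ β ∷ B) ≡ A ++ β ∷ B ++ n ∷ []
  meet-case2 = trans (meet-++ A _ _) (cong (A ++_) (cong₂ _∷_ (ℕ.m≥n⇒m⊓n≡n (ℕ.n≤1+n β)) (meet-extension B (n ∷ []))))

  join-case2 : join (A ++ suc β ∷ B ++ n ∷ []) (A ++ β ∷ B) ≡ A ++ suc β ∷ B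
  join-case2 = trans (join-++ A _ _) (cong (A ++_) (cong₂ _∷_ (ℕ.m≥n⇒m⊔n≡m (ℕ.n≤1+n β)) (join-extension B (n ∷ []))))

δ-⊓-⊔ : ∀ x y d → δ (x ⊓ y) d ℕ.+ δ (x ⊔ y) d ≡ δ x d ℕ.+ δ y d
δ-⊓-⊔ x y d with ℕ.≤-total x y
... | inj₁ x≤y rewrite ℕ.m≤n⇒m⊓n≡m x≤y | ℕ.m≤n⇒m⊔n≡n x≤y = refl
... | inj₂ y≤x rewrite ℕ.m≥n⇒m⊓n≡n y≤x | ℕ.m≥n⇒m⊔n≡m y≤x = ℕ.+-comm (δ y d) (δ x d)

count-meet-join : ∀ d a b → count d (meet a b) ℕ.+ count d (join a b) ≡ count d a ℕ.+ count d b
count-meet-join d [] b = ℕ.+-comm (count d b) 0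
count-meet-join d (x ∷ a) [] = refl
count-meet-join d (x ∷ a) (y ∷ b) = begin
  (δ (x ⊓ y) d ℕ.+ count d (meet a b)) ℕ.+ (δ (x ⊔ y) d ℕ.+ count d (join a b))
    ≡⟨ interchange (δ (x ⊓ y) d) _ _ _ ⟩
  (δ (x ⊓ y) d ℕ.+ δ (x ⊔ y) d) ℕ.+ (count d (meet a b) ℕ.+ count d (join a b))
    ≡⟨ cong₂ ℕ._+_ (δ-⊓-⊔ x y d) (count-meet-join d a b) ⟩
  (δ x d ℕ.+ δ y d) ℕ.+ (count d a ℕ.+ count d b)
    ≡⟨ interchange (δ x d) _ _ _ ⟩
  (δ x d ℕ.+ count d a) ℕ.+ (δ y d ℕ.+ count d b) ∎

join-linked : ∀ {a b} → Linked _<_ a → Linked _<_ b → Linked _<_ (join a b)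
join-linked [] _ = []
join-linked [-] [] = []
join-linked [-] [-] = [-]
join-linked [-] (_ ∷ _) = [-]
join-linked (_ ∷ _) [] = []
join-linked (_ ∷ _) [-] = [-]
join-linked (x<x′ ∷ a↑) (y<y′ ∷ b↑) = ℕ.⊔-mono-< x<x′ y<y′ ∷ join-linked a↑ b↑

meet-linked : ∀ {a b} → Linked _<_ a → Linked _<_ b → Linked _<_ (meet a b)
meet-linked [] b↑ = b↑
meet-linked [-] [] = [-]
meet-linked [-] [-] = [-]
meet-linked {x ∷ []} {y ∷ _} [-] (y<y′ ∷ b↑) = ℕ.≤-<-trans (ℕ.m⊓n≤n x y) y<y′ ∷ b↑
meet-linked (x<x′ ∷ a↑) [] = x<x′ ∷ a↑
meet-linked {x ∷ _} {y ∷ []} (x<x′ ∷ a↑) [-] = ℕ.≤-<-trans (ℕ.m⊓n≤m x y) x<x′ ∷ a↑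
meet-linked (x<x′ ∷ a↑) (y<y′ ∷ b↑) = ℕ.⊓-mono-< x<x′ y<y′ ∷ meet-linked a↑ b↑

join-bounded : ∀ {n a b} → All (λ x → 1 ≤ x × x ≤ n) a → All (λ x → 1 ≤ x × x ≤ n) b →
  All (λ x → 1 ≤ x × x ≤ n) (join a b)
join-bounded [] _ = []
join-bounded (_ ∷ _) [] = []
join-bounded {a = x ∷ _} {y ∷ _} ((1≤x , x≤n) ∷ a-bd) ((_ , y≤n) ∷ b-bd) =
  (ℕ.≤-trans 1≤x (ℕ.m≤m⊔n x y) , ℕ.⊔-lub x≤n y≤n) ∷ join-bounded a-bd b-bd

join-valid : ∀ {n a b} → Valid n a → Valid n b → Valid n (join a b)
join-valid {n} {a} {b} (1≤|a| , |a|<n , a-bd , a↑) (1≤|b| , _ , b-bd , b↑) =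
  subst (1 ≤_) (sym (length-join a b)) (ℕ.⊓-glb 1≤|a| 1≤|b|) ,
  subst (_< n) (sym (length-join a b)) (ℕ.≤-<-trans (ℕ.m⊓n≤m (length a) (length b)) |a|<n) ,
  join-bounded a-bd b-bd , join-linked a↑ b↑

squeeze : ∀ U x V e → (U ++ x ∷ V) ≼ e → e ≼ (U ++ suc x ∷ V) → e ≡ U ++ x ∷ V ⊎ e ≡ U ++ suc x ∷ V
squeeze [] x V (e ∷ es) (x≤e , V≼es) (e≤1+x , es≼V) with ≼-antisym V≼es es≼V | ℕ.m≤n⇒m<n∨m≡n e≤1+x
... | refl | inj₁ (s≤s e≤x) = inj₁ (cong (_∷ V) (ℕ.≤-antisym e≤x x≤e))
... | refl | inj₂ refl = inj₂ refl
squeeze (u ∷ U) x V (e ∷ es) (u≤e , h₁) (e≤u , h₂) with ℕ.≤-antisym e≤u u≤e | squeeze U x V es h₁ h₂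
... | refl | inj₁ refl = inj₁ refl
... | refl | inj₂ refl = inj₂ refl

raise-covers : ∀ n U x V → Covers n (U ++ x ∷ V) (U ++ suc x ∷ V)
raise-covers n U x V =
  (≼-++ U (ℕ.n≤1+n x , ≼-refl V) , ℕ.<⇒≢ (ℕ.n<1+n x) ∘ ∷-injectiveˡ ∘ ++-cancelˡ U _ _) ,
  λ e _ → squeeze U x V e

raise-below : ∀ {j q} → length j ≡ length q → j ≼ q → j ≢ q → Linked _<_ j → Linked _<_ q →
  ∃ λ U → ∃ λ x → ∃ λ V → j ≡ U ++ x ∷ V × Linked _<_ (U ++ suc x ∷ V) × (U ++ suc x ∷ V) ≼ q
raise-below {[]} {[]} _ _ j≢q _ _ = ⊥-elim (j≢q refl)
raise-below {x ∷ xs} {y ∷ ys} |j|≡|q| (x≤y , xs≼ys) j≢q j↑ q↑ with ≡-dec ℕ._≟_ xs ys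
... | yes refl = [] , x , xs , refl , linked-lower q↑ x<y , x<y , ≼-refl xs
  where
  x<y : x < y
  x<y = ℕ.≤∧≢⇒< x≤y (j≢q ∘ cong (_∷ xs))
... | no xs≢ys with raise-below (ℕ.suc-injective |j|≡|q|) xs≼ys xs≢ys (linked-tail j↑) (linked-tail q↑)
...   | U , x′ , V , refl , raised↑ , raised≼ys = x ∷ U , x′ , V , refl , linked-cons-raise U j↑ raised↑ , x≤y , raised≼ys

≼-lowerBound : ∀ {j e} → j ≼ e → All (1 ≤_) j → All (1 ≤_) e
≼-lowerBound {e = []} _ _ = []
≼-lowerBound {x ∷ j} {y ∷ e} (x≤y , j≼e) (1≤x ∷ j-bd) = ℕ.≤-trans 1≤x x≤y ∷ ≼-lowerBound j≼e j-bd

≼-upperBound : ∀ {n e q} → e ≼ q → length e ≡ length q → All (_≤ n) q → All (_≤ n) e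
≼-upperBound {e = []} _ _ _ = []
≼-upperBound {e = x ∷ e} {y ∷ q} (x≤y , e≼q) |e|≡|q| (y≤n ∷ q-bd) =
  ℕ.≤-trans x≤y y≤n ∷ ≼-upperBound e≼q (ℕ.suc-injective |e|≡|q|) q-bd

covers-sameLength : ∀ {n j q} → Covers n j q → Valid n j → Valid n q → length j ≡ length q →
  ∃ λ U → ∃ λ x → ∃ λ V → j ≡ U ++ x ∷ V × q ≡ U ++ suc x ∷ V
covers-sameLength {n} {j} {q} ((j≼q , j≢q) , between) (1≤|j| , |j|<n , j-bd , j↑) (_ , _ , q-bd , q↑) |j|≡|q|
  with raise-below |j|≡|q| j≼q j≢q j↑ q↑
... | U , x , V , refl , raised↑ , raised≼q with between (U ++ suc x ∷ V) raised-valid j≼raised raised≼q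
  where
  j≼raised = ≼-++ U (ℕ.n≤1+n x , ≼-refl V)
  |raised|≡|j| : length (U ++ suc x ∷ V) ≡ length (U ++ x ∷ V)
  |raised|≡|j| = trans (length-++ U) (sym (length-++ U))
  raised-valid : Valid n (U ++ suc x ∷ V)
  raised-valid = subst (1 ≤_) (sym |raised|≡|j|) 1≤|j| , subst (_< n) (sym |raised|≡|j|) |j|<n ,
    All.zip (≼-lowerBound j≼raised (All.map proj₁ j-bd) ,
             ≼-upperBound raised≼q (trans |raised|≡|j| |j|≡|q|) (All.map proj₂ q-bd)) ,
    raised↑
...   | inj₁ raised≡j = ⊥-elim (ℕ.<⇒≢ (ℕ.n<1+n x) (sym (∷-injectiveˡ (++-cancelˡ U _ _ raised≡j))))
...   | inj₂ raised≡q = U , x , V , refl , sym raised≡q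

Exchange : List ℕ → List ℕ → ℕ → Set
Exchange a b x = x ∈ join a b × x ∉ meet a b × suc x ∈ meet a b × suc x ∉ join a b

count-raise : ∀ d U x V → count d (U ++ x ∷ V) ℕ.+ δ (suc x) d ≡ count d (U ++ suc x ∷ V) ℕ.+ δ x d
count-raise d U x V = begin
  count d (U ++ x ∷ V) ℕ.+ δ (suc x) d                       ≡⟨ cong (ℕ._+ δ (suc x) d) (count-++ d U (x ∷ V)) ⟩
  count d U ℕ.+ (δ x d ℕ.+ count d V) ℕ.+ δ (suc x) d        ≡⟨ swap-middle (count d U) (δ x d) (count d V) (δ (suc x) d) ⟩
  count d U ℕ.+ (δ (suc x) d ℕ.+ count d V) ℕ.+ δ x d        ≡⟨ cong (ℕ._+ δ x d) (count-++ d U (suc x ∷ V)) ⟨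
  count d (U ++ suc x ∷ V) ℕ.+ δ x d                         ∎
  where
  swap-middle : ∀ u a v b → u ℕ.+ (a ℕ.+ v) ℕ.+ b ≡ u ℕ.+ (b ℕ.+ v) ℕ.+ a
  swap-middle = ℕ-Solver.solve-∀

counts⇒exchange : ∀ {m p} U x V → AllPairs _<_ p → AllPairs _<_ (U ++ suc x ∷ V) →
  (∀ d → count d m ℕ.+ count d (U ++ x ∷ V) ≡ count d p ℕ.+ count d (U ++ suc x ∷ V)) →
  x ∈ U ++ x ∷ V × x ∉ m × suc x ∈ m × suc x ∉ U ++ x ∷ V
counts⇒exchange {m} {p} U x V p↑ q↑ balance =
  ∈-++⁺ʳ U (here refl) ,
  (λ x∈m → ℕ.n≮n 1 (ℕ.≤-trans (ℕ.+-monoˡ-≤ 1 (count-∈ x∈m)) (subst (_≤ 1) (sym at-x) (count-≤1 p↑)))) ,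
  1≤count⇒∈ m (subst (1 ≤_) (sym at-1+x) (ℕ.m≤n+m 1 (count (suc x) p))) ,
  (λ 1+x∈j → ℕ.n≮n 1 (ℕ.≤-trans (ℕ.+-monoˡ-≤ 1 (count-∈ 1+x∈j)) (subst (_≤ 1) (sym j-at-1+x) (count-≤1 q↑))))
  where
  j = U ++ x ∷ V
  q = U ++ suc x ∷ V
  exchange : ∀ d → count d m ℕ.+ δ x d ≡ count d p ℕ.+ δ (suc x) d
  exchange d = ℕ.+-cancelʳ-≡ (count d q) _ _ (begin
    count d m ℕ.+ δ x d ℕ.+ count d q
      ≡⟨ ℕ.+-assoc (count d m) (δ x d) (count d q) ⟩
    count d m ℕ.+ (δ x d ℕ.+ count d q)
      ≡⟨ cong (count d m ℕ.+_) (trans (ℕ.+-comm (δ x d) (count d q)) (sym (count-raise d U x V))) ⟩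
    count d m ℕ.+ (count d j ℕ.+ δ (suc x) d)
      ≡⟨ ℕ.+-assoc (count d m) (count d j) (δ (suc x) d) ⟨
    count d m ℕ.+ count d j ℕ.+ δ (suc x) d
      ≡⟨ cong (ℕ._+ δ (suc x) d) (balance d) ⟩
    count d p ℕ.+ count d q ℕ.+ δ (suc x) d
      ≡⟨ xy∙z≈xz∙y (count d p) (count d q) (δ (suc x) d) ⟩
    count d p ℕ.+ δ (suc x) d ℕ.+ count d q         ∎)
  at-x : count x m ℕ.+ 1 ≡ count x p
  at-x = trans (cong (count x m ℕ.+_) (sym (δ-refl x)))
    (trans (exchange x) (trans (cong (count x p ℕ.+_) (δ-≢ (ℕ.<⇒≢ (ℕ.n<1+n x) ∘ sym))) (ℕ.+-identityʳ _)))
  at-1+x : count (suc x) m ≡ count (suc x) p ℕ.+ 1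
  at-1+x = trans (sym (trans (cong (count (suc x) m ℕ.+_) (δ-≢ (ℕ.<⇒≢ (ℕ.n<1+n x)))) (ℕ.+-identityʳ _)))
             (trans (exchange (suc x)) (cong (count (suc x) p ℕ.+_) (δ-refl (suc x))))
  j-at-1+x : count (suc x) j ℕ.+ 1 ≡ count (suc x) q
  j-at-1+x = trans (cong (count (suc x) j ℕ.+_) (sym (δ-refl (suc x))))
    (trans (count-raise (suc x) U x V) (trans (cong (count (suc x) q ℕ.+_) (δ-≢ (ℕ.<⇒≢ (ℕ.n<1+n x)))) (ℕ.+-identityʳ _)))

special⇒exchange : ∀ {n a b z} → Valid n a → Valid n b → Separates z a b → Special n a b → ∃ (Exchange a b)
special⇒exchange {n} {a} {b} {z} va vb sep (p , q , c , vp , vq , (p≼q , _) , _ , _ , I , cov) =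
  exchange (covers-sameLength cov (join-valid va vb) vq (sym |q|≡|j|))
  where
  m = meet a b
  j = join a b
  |q|≡|j| : length q ≡ length j
  |q|≡|j| = trans (rowCounts⇒length (row-balance {a} {b} {c} {p} {q} {z} I sep) (proj₁ vq) (≼-length p≼q)) (sym (length-join a b))
  balance : ∀ d → count d m ℕ.+ count d j ≡ count d p ℕ.+ count d q
  balance d = trans (count-meet-join d a b)
    (column-balance {a} {b} {c} {p} {q} {z} I sep (increasing va) (increasing vb) (increasing vp) (increasing vq) d)
  exchange : (∃ λ U → ∃ λ x → ∃ λ V → j ≡ U ++ x ∷ V × q ≡ U ++ suc x ∷ V) → ∃ (Exchange a b)
  exchange (U , x , V , j≡ , q≡)
    with counts⇒exchange U x V (increasing vp) (subst (AllPairs _<_) q≡ (increasing vq))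
           (λ d → subst₂ (λ s t → count d m ℕ.+ count d s ≡ count d p ℕ.+ count d t) j≡ q≡ (balance d))
  ... | x∈j , x∉m , 1+x∈m , 1+x∉j = x , subst (x ∈_) (sym j≡) x∈j , x∉m , 1+x∈m , subst (suc x ∉_) (sym j≡) 1+x∉j

-- Separating matrices

indicator : List ℕ → ℕ → ℚ
indicator S d with d ∈? S
... | yes _ = 1ℚ
... | no _ = 0ℚ

indicator-∈ : ∀ S {d} → d ∈ S → indicator S d ≡ 1ℚ
indicator-∈ S {d} d∈S with d ∈? S
... | yes _ = refl
... | no d∉S = ⊥-elim (d∉S d∈S)

indicator-∉ : ∀ {S d} → d ∉ S → indicator S d ≡ 0ℚ
indicator-∉ {S} {d} d∉S with d ∈? S
... | yes d∈S = ⊥-elim (d∉S d∈S)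
... | no _ = refl

indicator-pair-∉ : ∀ {u v d} → d ≢ u → d ≢ v → indicator (u ∷ v ∷ []) d ≡ 0ℚ
indicator-pair-∉ d≢u d≢v = indicator-∉ (All¬⇒¬Any (d≢u ∷ d≢v ∷ []))

unit : ℕ → ℕ → ℚ
unit a = indicator (a ∷ [])

fromRows : List (ℕ → ℚ) → ℕ → ℕ → ℚ
fromRows [] i d = 0ℚ
fromRows (R ∷ Rs) zero d = R d
fromRows (R ∷ Rs) (suc i) d = fromRows Rs i d

detF-shift : ∀ k z r L → detF k z (suc r) L ≡ detF k (λ i → z (suc i)) r L
detF-shift zero z r L = refl
detF-shift (suc k) z r L = expand-congʳ (z (suc r)) L (λ es _ → detF-shift k z (suc r) es)

detF-fromRows-∷ : ∀ k R Rs L → detF (suc k) (fromRows (R ∷ Rs)) 0 L ≡ expand R (detF k (fromRows Rs) 0) L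
detF-fromRows-∷ k R Rs L = expand-congʳ R L (λ es _ → detF-shift k (fromRows (R ∷ Rs)) 0 es)

plucker-fromRows : ∀ R Rs x → plucker (fromRows (R ∷ Rs)) x ≡ detF (length x) (fromRows Rs) 0 x
plucker-fromRows R Rs x = detF-shift (length x) (fromRows (R ∷ Rs)) 0 x

detF-zeroRow : ∀ k {f} Rs L → All (λ d → f d ≡ 0ℚ) L → detF (suc k) (fromRows (f ∷ Rs)) 0 L ≡ 0ℚ
detF-zeroRow k {f} Rs L f≡0 = trans (detF-fromRows-∷ k f Rs L) (expand-vanishingˡ _ L f≡0)

detF-unitEntry : ∀ k {f} Rs X s Y → f s ≡ 1ℚ → All (λ d → f d ≡ 0ℚ) X → All (λ d → f d ≡ 0ℚ) Y →
  detF (suc k) (fromRows (f ∷ Rs)) 0 (X ++ s ∷ Y) ≡ sign (length X) * detF k (fromRows Rs) 0 (X ++ Y)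
detF-unitEntry k {f} Rs X s Y fs≡1 f≡0ˣ f≡0ʸ = begin
  detF (suc k) (fromRows (f ∷ Rs)) 0 (X ++ s ∷ Y)      ≡⟨ detF-fromRows-∷ k f Rs (X ++ s ∷ Y) ⟩
  expand f D (X ++ s ∷ Y)                             ≡⟨ expand-single D X s Y f≡0ˣ f≡0ʸ ⟩
  sign (length X) * (f s * D (X ++ Y))                ≡⟨ cong (λ t → sign (length X) * (t * D (X ++ Y))) fs≡1 ⟩
  sign (length X) * (1ℚ * D (X ++ Y))                 ≡⟨ cong (sign (length X) *_) (ℚ.*-identityˡ (D (X ++ Y))) ⟩
  sign (length X) * D (X ++ Y)                        ∎
  where D = detF k (fromRows Rs) 0

unitRows : List ℕ → List (ℕ → ℚ) → List (ℕ → ℚ)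
unitRows [] Rs = Rs
unitRows (a ∷ A) Rs = unit a ∷ unitRows A Rs

detF-unitRows-after : ∀ X A L k Rs → All (_∉ A) X → AllPairs _<_ (A ++ L) →
  detF (length A ℕ.+ k) (fromRows (unitRows A Rs)) 0 (X ++ A ++ L) ≡ sign (length X ℕ.* length A) * detF k (fromRows Rs) 0 (X ++ L)
detF-unitRows-after X [] L k Rs _ _ =
  sym (trans (cong (λ e → sign e * D) (ℕ.*-zeroʳ (length X))) (ℚ.*-identityˡ D))
  where D = detF k (fromRows Rs) 0 (X ++ L)
detF-unitRows-after X (a ∷ A) L k Rs X∉ (a<AL ∷ AL↑) = begin
  detF (suc (length A ℕ.+ k)) (fromRows (unit a ∷ unitRows A Rs)) 0 (X ++ a ∷ A ++ L)
    ≡⟨ detF-unitEntry (length A ℕ.+ k) (unitRows A Rs) X a (A ++ L) (indicator-∈ (a ∷ []) (here refl))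
         (All.map (λ x∉aA → indicator-∉ (x∉aA ∘ here ∘ ∈-single)) X∉)
         (All.map (λ a<d → indicator-∉ (ℕ.<⇒≢ a<d ∘ sym ∘ ∈-single)) a<AL) ⟩
  sign (length X) * detF (length A ℕ.+ k) (fromRows (unitRows A Rs)) 0 (X ++ A ++ L)
    ≡⟨ cong (sign (length X) *_) (detF-unitRows-after X A L k Rs (All.map (_∘ there) X∉) AL↑) ⟩
  sign (length X) * (sign (length X ℕ.* length A) * D)
    ≡⟨ ℚ.*-assoc (sign (length X)) (sign (length X ℕ.* length A)) D ⟨
  sign (length X) * sign (length X ℕ.* length A) * D
    ≡⟨ cong (_* D) (trans (cong sign (ℕ.*-suc (length X) (length A))) (sign-+ (length X) (length X ℕ.* length A))) ⟨
  sign (length X ℕ.* suc (length A)) * D ∎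
  where
  D = detF k (fromRows Rs) 0 (X ++ L)
  ∈-single : ∀ {d} → d ∈ a ∷ [] → d ≡ a
  ∈-single (here d≡a) = d≡a

detF-unitRows : ∀ A L k Rs → AllPairs _<_ (A ++ L) →
  detF (length A ℕ.+ k) (fromRows (unitRows A Rs)) 0 (A ++ L) ≡ detF k (fromRows Rs) 0 L
detF-unitRows A L k Rs AL↑ = trans (detF-unitRows-after [] A L k Rs [] AL↑) (ℚ.*-identityˡ (detF k (fromRows Rs) 0 L))

plucker-unitRows : ∀ R A Rs L → AllPairs _<_ (A ++ L) →
  plucker (fromRows (R ∷ unitRows A Rs)) (A ++ L) ≡ detF (length L) (fromRows Rs) 0 L
plucker-unitRows R A Rs L AL↑ = trans (plucker-fromRows R (unitRows A Rs) (A ++ L))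
  (trans (cong (λ k → detF k (fromRows (unitRows A Rs)) 0 (A ++ L)) (length-++ A)) (detF-unitRows A L (length L) Rs AL↑))

detF-unitRows-self : ∀ A Rs → AllPairs _<_ A → detF (length A) (fromRows (unitRows A Rs)) 0 A ≡ 1ℚ
detF-unitRows-self A Rs A↑ =
  subst₂ (λ k L → detF k (fromRows (unitRows A Rs)) 0 L ≡ 1ℚ) (ℕ.+-identityʳ (length A)) (++-identityʳ A)
    (detF-unitRows A [] 0 Rs (subst (AllPairs _<_) (sym (++-identityʳ A)) A↑))

module Case1Witness (A B C : List ℕ) (α γ : ℕ)
  (a↑ : AllPairs _<_ (A ++ α ∷ B ++ suc γ ∷ C)) (b↑ : AllPairs _<_ (A ++ suc α ∷ B ++ γ ∷ C)) where

  private
    a = A ++ α ∷ B ++ suc γ ∷ C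
    b = A ++ suc α ∷ B ++ γ ∷ C
    α⁺ = suc α
    γ⁺ = suc γ
    f₂ = indicator (α⁺ ∷ γ⁺ ∷ [])
    f₁ = indicator (α ∷ γ ∷ [])
    rest = unitRows (B ++ C) []
    α<Bγ⁺C : All (α <_) (B ++ γ⁺ ∷ C)
    α<Bγ⁺C = AllPairs.head (allPairs-dropPrefix A a↑)
    Bγ⁺C↑ : AllPairs _<_ (B ++ γ⁺ ∷ C)
    Bγ⁺C↑ = allPairs-dropPrefix (α ∷ []) (allPairs-dropPrefix A a↑)
    α⁺<BγC : All (α⁺ <_) (B ++ γ ∷ C)
    α⁺<BγC = AllPairs.head (allPairs-dropPrefix A b↑)
    α⁺<γ : α⁺ < γ
    α⁺<γ = All.head (++⁻ʳ B α⁺<BγC)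
    α⁺<B<γ : All (λ d → α⁺ < d × d < γ) B
    α⁺<B<γ = All.zip (++⁻ˡ B α⁺<BγC , allPairs-beforeMiddle B (allPairs-dropPrefix (α⁺ ∷ []) (allPairs-dropPrefix A b↑)))
    γ⁺<C : All (γ⁺ <_) C
    γ⁺<C = AllPairs.head (allPairs-dropPrefix B Bγ⁺C↑)
    BC↑ : AllPairs _<_ (B ++ C)
    BC↑ = allPairs-deleteMiddle B Bγ⁺C↑
    f₂-B : All (λ d → f₂ d ≡ 0ℚ) B
    f₂-B = All.map (λ (α⁺<d , d<γ) → indicator-pair-∉ (ℕ.>⇒≢ α⁺<d) (ℕ.<⇒≢ (ℕ.<-trans d<γ (ℕ.n<1+n γ)))) α⁺<B<γ
    f₂-C : All (λ d → f₂ d ≡ 0ℚ) C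
    f₂-C = All.map (λ γ⁺<d → indicator-pair-∉ (ℕ.>⇒≢ (ℕ.<-trans (ℕ.<-trans α⁺<γ (ℕ.n<1+n γ)) γ⁺<d)) (ℕ.>⇒≢ γ⁺<d))
             γ⁺<C
    f₁-B : All (λ d → f₁ d ≡ 0ℚ) B
    f₁-B = All.map (λ (α⁺<d , d<γ) → indicator-pair-∉ (ℕ.>⇒≢ (ℕ.<-trans (ℕ.n<1+n α) α⁺<d)) (ℕ.<⇒≢ d<γ)) α⁺<B<γ
    f₁-C : All (λ d → f₁ d ≡ 0ℚ) C
    f₁-C = All.map (λ γ⁺<d → indicator-pair-∉ (ℕ.>⇒≢ (ℕ.<-trans (All.head (++⁻ʳ B α<Bγ⁺C)) γ⁺<d))
                                               (ℕ.>⇒≢ (ℕ.<-trans (ℕ.n<1+n γ) γ⁺<d)))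
             γ⁺<C
    f₂-α : f₂ α ≡ 0ℚ
    f₂-α = indicator-pair-∉ (ℕ.<⇒≢ (ℕ.n<1+n α)) (ℕ.<⇒≢ (All.head (++⁻ʳ B α<Bγ⁺C)))
    f₂-γ : f₂ γ ≡ 0ℚ
    f₂-γ = indicator-pair-∉ (ℕ.>⇒≢ α⁺<γ) (ℕ.<⇒≢ (ℕ.n<1+n γ))

  -- Rows e_d (d ∈ A), e_{α+1} + e_{γ+1}, e_α + e_γ, e_d (d ∈ B ++ C): the minors at a and b are ±1, and
  -- e_{α+1} + e_{γ+1} vanishes on the columns of a ∧ b. plucker reads rows from 1 on, so row 0 is a dummy.
  z₀ : ℕ → ℕ → ℚ
  z₀ = fromRows ((λ _ → 0ℚ) ∷ unitRows A (f₂ ∷ f₁ ∷ rest))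

  minor-meet : plucker z₀ (A ++ α ∷ B ++ γ ∷ C) ≡ 0ℚ
  minor-meet = trans (plucker-unitRows (λ _ → 0ℚ) A (f₂ ∷ f₁ ∷ rest) (α ∷ B ++ γ ∷ C) m↑)
    (detF-zeroRow (length (B ++ γ ∷ C)) (f₁ ∷ rest) (α ∷ B ++ γ ∷ C) (f₂-α ∷ ++⁺ f₂-B (f₂-γ ∷ f₂-C)))
    where
    m↑ : AllPairs _<_ (A ++ α ∷ B ++ γ ∷ C)
    m↑ = subst (AllPairs _<_) (meet-case1 A B C α γ)
      (Linked⇒AllPairs ℕ.<-trans (meet-linked (AllPairs⇒Linked a↑) (AllPairs⇒Linked b↑)))

  minor-a : plucker z₀ a ≡ sign (suc (length B))
  minor-a = begin
    plucker z₀ a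
      ≡⟨ plucker-unitRows (λ _ → 0ℚ) A (f₂ ∷ f₁ ∷ rest) (α ∷ B ++ γ⁺ ∷ C) a↑ ⟩
    detF (suc (length (B ++ γ⁺ ∷ C))) (fromRows (f₂ ∷ f₁ ∷ rest)) 0 ((α ∷ B) ++ γ⁺ ∷ C)
      ≡⟨ detF-unitEntry (length (B ++ γ⁺ ∷ C)) (f₁ ∷ rest) (α ∷ B) γ⁺ C
           (indicator-∈ (α⁺ ∷ γ⁺ ∷ []) (there (here refl))) (f₂-α ∷ f₂-B) f₂-C ⟩
    sign (suc (length B)) * detF (length (B ++ γ⁺ ∷ C)) (fromRows (f₁ ∷ rest)) 0 (α ∷ B ++ C)
      ≡⟨ cong (λ k → sign (suc (length B)) * detF k (fromRows (f₁ ∷ rest)) 0 (α ∷ B ++ C)) (length-++-sucʳ B γ⁺ C) ⟩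
    sign (suc (length B)) * detF (suc (length (B ++ C))) (fromRows (f₁ ∷ rest)) 0 ([] ++ α ∷ B ++ C)
      ≡⟨ cong (sign (suc (length B)) *_)
           (detF-unitEntry (length (B ++ C)) rest [] α (B ++ C) (indicator-∈ (α ∷ γ ∷ []) (here refl)) [] (++⁺ f₁-B f₁-C)) ⟩
    sign (suc (length B)) * (1ℚ * detF (length (B ++ C)) (fromRows rest) 0 (B ++ C))
      ≡⟨ cong (λ t → sign (suc (length B)) * (1ℚ * t)) (detF-unitRows-self (B ++ C) [] BC↑) ⟩
    sign (suc (length B)) * 1ℚ
      ≡⟨ ℚ.*-identityʳ (sign (suc (length B))) ⟩
    sign (suc (length B)) ∎

  minor-b : plucker z₀ b ≡ sign (length B)
  minor-b = begin
    plucker z₀ b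
      ≡⟨ plucker-unitRows (λ _ → 0ℚ) A (f₂ ∷ f₁ ∷ rest) (α⁺ ∷ B ++ γ ∷ C) b↑ ⟩
    detF (suc (length (B ++ γ ∷ C))) (fromRows (f₂ ∷ f₁ ∷ rest)) 0 ([] ++ α⁺ ∷ B ++ γ ∷ C)
      ≡⟨ detF-unitEntry (length (B ++ γ ∷ C)) (f₁ ∷ rest) [] α⁺ (B ++ γ ∷ C)
           (indicator-∈ (α⁺ ∷ γ⁺ ∷ []) (here refl)) [] (++⁺ f₂-B (f₂-γ ∷ f₂-C)) ⟩
    1ℚ * detF (length (B ++ γ ∷ C)) (fromRows (f₁ ∷ rest)) 0 (B ++ γ ∷ C)
      ≡⟨ ℚ.*-identityˡ _ ⟩
    detF (length (B ++ γ ∷ C)) (fromRows (f₁ ∷ rest)) 0 (B ++ γ ∷ C)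
      ≡⟨ cong (λ k → detF k (fromRows (f₁ ∷ rest)) 0 (B ++ γ ∷ C)) (length-++-sucʳ B γ C) ⟩
    detF (suc (length (B ++ C))) (fromRows (f₁ ∷ rest)) 0 (B ++ γ ∷ C)
      ≡⟨ detF-unitEntry (length (B ++ C)) rest B γ C (indicator-∈ (α ∷ γ ∷ []) (there (here refl))) f₁-B f₁-C ⟩
    sign (length B) * detF (length (B ++ C)) (fromRows rest) 0 (B ++ C)
      ≡⟨ cong (sign (length B) *_) (detF-unitRows-self (B ++ C) [] BC↑) ⟩
    sign (length B) * 1ℚ
      ≡⟨ ℚ.*-identityʳ (sign (length B)) ⟩
    sign (length B) ∎

  separates : Separates z₀ a b
  separates =
    trans (cong (λ x → plucker z₀ x * plucker z₀ (join a b)) (meet-case1 A B C α γ))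
      (trans (cong (_* plucker z₀ (join a b)) minor-meet) (ℚ.*-zeroˡ (plucker z₀ (join a b)))) ,
    sign-≢0 (suc (length B) ℕ.+ length B)
      ∘ trans (sign-+ (suc (length B)) (length B)) ∘ trans (cong₂ _*_ (sym minor-a) (sym minor-b))

module Case2Witness (A B : List ℕ) (β n : ℕ)
  (a↑ : AllPairs _<_ (A ++ suc β ∷ B ++ n ∷ [])) (b↑ : AllPairs _<_ (A ++ β ∷ B)) where

  private
    a = A ++ suc β ∷ B ++ n ∷ []
    b = A ++ β ∷ B
    β⁺ = suc β
    f = indicator (β ∷ n ∷ [])
    g = unit β⁺
    rest = unitRows B (g ∷ [])
    β⁺Bn↑ : AllPairs _<_ (β⁺ ∷ B ++ n ∷ [])
    β⁺Bn↑ = allPairs-dropPrefix A a↑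
    β⁺<Bn : All (β⁺ <_) (B ++ n ∷ [])
    β⁺<Bn = AllPairs.head β⁺Bn↑
    β⁺<n : β⁺ < n
    β⁺<n = All.head (++⁻ʳ B β⁺<Bn)
    β⁺∉B : β⁺ ∉ B
    β⁺∉B = All¬⇒¬Any (All.map ℕ.<⇒≢ (++⁻ˡ B β⁺<Bn))
    f-B : All (λ d → f d ≡ 0ℚ) B
    f-B = All.zipWith (λ (β⁺<d , d<n) → indicator-pair-∉ (ℕ.>⇒≢ (ℕ.<-trans (ℕ.n<1+n β) β⁺<d)) (ℕ.<⇒≢ d<n))
            (++⁻ˡ B β⁺<Bn , allPairs-beforeMiddle B (AllPairs.tail β⁺Bn↑))
    f-β⁺ : f β⁺ ≡ 0ℚ
    f-β⁺ = indicator-pair-∉ (ℕ.>⇒≢ (ℕ.n<1+n β)) (ℕ.<⇒≢ β⁺<n)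

  -- Rows e_d (d ∈ A), e_β + e_n, e_d (d ∈ B), e_{β+1}: the minors at a and b are ±1, and the row e_β + e_n
  -- vanishes on the columns of a ∨ b. plucker reads rows from 1 on, so row 0 is a dummy.
  z₀ : ℕ → ℕ → ℚ
  z₀ = fromRows ((λ _ → 0ℚ) ∷ unitRows A (f ∷ rest))

  minor-join : plucker z₀ (A ++ β⁺ ∷ B) ≡ 0ℚ
  minor-join = trans (plucker-unitRows (λ _ → 0ℚ) A (f ∷ rest) (β⁺ ∷ B) j↑)
                     (detF-zeroRow (length B) rest (β⁺ ∷ B) (f-β⁺ ∷ f-B))
    where
    j↑ : AllPairs _<_ (A ++ β⁺ ∷ B)
    j↑ = subst (AllPairs _<_) (join-case2 A B β n)
      (Linked⇒AllPairs ℕ.<-trans (join-linked (AllPairs⇒Linked a↑) (AllPairs⇒Linked b↑)))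

  minor-a : plucker z₀ a ≡ sign (suc (length B)) * sign (1 ℕ.* length B)
  minor-a = begin
    plucker z₀ a
      ≡⟨ plucker-unitRows (λ _ → 0ℚ) A (f ∷ rest) (β⁺ ∷ B ++ n ∷ []) a↑ ⟩
    detF (suc (length (B ++ n ∷ []))) (fromRows (f ∷ rest)) 0 ((β⁺ ∷ B) ++ n ∷ [])
      ≡⟨ detF-unitEntry (length (B ++ n ∷ [])) rest (β⁺ ∷ B) n []
           (indicator-∈ (β ∷ n ∷ []) (there (here refl))) (f-β⁺ ∷ f-B) [] ⟩
    sign (suc (length B)) * detF (length (B ++ n ∷ [])) (fromRows rest) 0 ((β⁺ ∷ []) ++ B ++ [])
      ≡⟨ cong (λ k → sign (suc (length B)) * detF k (fromRows rest) 0 ((β⁺ ∷ []) ++ B ++ [])) (length-++ B) ⟩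
    sign (suc (length B)) * detF (length B ℕ.+ 1) (fromRows rest) 0 ((β⁺ ∷ []) ++ B ++ [])
      ≡⟨ cong (sign (suc (length B)) *_)
           (detF-unitRows-after (β⁺ ∷ []) B [] 1 (g ∷ []) (β⁺∉B ∷ []) (allPairs-deleteMiddle B (AllPairs.tail β⁺Bn↑))) ⟩
    sign (suc (length B)) * (sign (1 ℕ.* length B) * detF 1 (fromRows (g ∷ [])) 0 (β⁺ ∷ []))
      ≡⟨ cong (λ t → sign (suc (length B)) * (sign (1 ℕ.* length B) * t))
           (detF-unitEntry 0 {g} [] [] β⁺ [] (indicator-∈ (β⁺ ∷ []) (here refl)) [] []) ⟩
    sign (suc (length B)) * (sign (1 ℕ.* length B) * 1ℚ)
      ≡⟨ cong (sign (suc (length B)) *_) (ℚ.*-identityʳ (sign (1 ℕ.* length B))) ⟩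
    sign (suc (length B)) * sign (1 ℕ.* length B) ∎

  minor-b : plucker z₀ b ≡ 1ℚ
  minor-b = begin
    plucker z₀ b
      ≡⟨ plucker-unitRows (λ _ → 0ℚ) A (f ∷ rest) (β ∷ B) b↑ ⟩
    detF (suc (length B)) (fromRows (f ∷ rest)) 0 ([] ++ β ∷ B)
      ≡⟨ detF-unitEntry (length B) rest [] β B (indicator-∈ (β ∷ n ∷ []) (here refl)) [] f-B ⟩
    1ℚ * detF (length B) (fromRows rest) 0 B
      ≡⟨ cong (1ℚ *_) (detF-unitRows-self B (g ∷ []) (AllPairs.tail (allPairs-dropPrefix A b↑))) ⟩
    1ℚ ∎

  separates : Separates z₀ a b
  separates =
    trans (cong (λ x → plucker z₀ (meet a b) * plucker z₀ x) (join-case2 A B β n))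
      (trans (cong (plucker z₀ (meet a b) *_) minor-join) (ℚ.*-zeroʳ (plucker z₀ (meet a b)))) ,
    sign-≢0 (suc (length B) ℕ.+ 1 ℕ.* length B) ∘ trans (sign-+ (suc (length B)) (1 ℕ.* length B))
      ∘ trans (sym (trans (cong₂ _*_ minor-a minor-b) (ℚ.*-identityʳ (sign (suc (length B)) * sign (1 ℕ.* length B)))))

∈-gap : ∀ (A B : List ℕ) {u e} → e ∈ A ++ u ∷ B → e ∉ A → e ∉ B → e ≡ u
∈-gap A B e∈ e∉A e∉B with ∈-++⁻ A e∈
... | inj₁ e∈A = ⊥-elim (e∉A e∈A)
... | inj₂ (here e≡u) = e≡u
... | inj₂ (there e∈B) = ⊥-elim (e∉B e∈B)

∈-gaps : ∀ (A B C : List ℕ) {u v e} → e ∈ A ++ u ∷ B ++ v ∷ C → e ∉ A → e ∉ B → e ∉ C → e ≡ u ⊎ e ≡ v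
∈-gaps A B C e∈ e∉A e∉B e∉C with ∈-++⁻ A e∈
... | inj₁ e∈A = ⊥-elim (e∉A e∈A)
... | inj₂ (here e≡u) = inj₁ e≡u
... | inj₂ (there e∈BvC) = inj₂ (∈-gap B C e∈BvC e∉B e∉C)

nothing-between : ∀ {u} B {C} → AllPairs _<_ (u ∷ B ++ suc u ∷ C) → B ≡ []
nothing-between [] _ = refl
nothing-between (e ∷ B) ((u<e ∷ _) ∷ e<BuC ∷ _) = ⊥-elim (ℕ.<⇒≱ u<e (ℕ.≤-pred (All.head (++⁻ʳ B e<BuC))))

2+n≢n : ∀ n → suc (suc n) ≢ n
2+n≢n n 2+n≡n = ℕ.<⇒≢ (ℕ.m<n+m n {2} (s≤s z≤n)) (sym 2+n≡n)

exchange⇒criterion₁ : ∀ A B C α γ {x} → AllPairs _<_ (A ++ suc α ∷ B ++ γ ∷ C) →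
  Exchange (A ++ α ∷ B ++ suc γ ∷ C) (A ++ suc α ∷ B ++ γ ∷ C) x → B ≡ [] × suc (suc α) ≡ γ
exchange⇒criterion₁ A B C α γ {x} b↑ (x∈j , x∉m , 1+x∈m , 1+x∉j) =
  nothing-between B (subst (λ t → AllPairs _<_ (suc α ∷ B ++ t ∷ C)) (sym γ≡) α⁺BγC↑) , γ≡
  where
  m≡ = meet-case1 A B C α γ
  j≡ = join-case1 A B C α γ
  x∉ = subst (x ∉_) m≡ x∉m
  1+x∉ = subst (suc x ∉_) j≡ 1+x∉j
  α⁺BγC↑ : AllPairs _<_ (suc α ∷ B ++ γ ∷ C)
  α⁺BγC↑ = allPairs-dropPrefix A b↑
  α⁺<γ : suc α < γ
  α⁺<γ = All.head (++⁻ʳ B (AllPairs.head α⁺BγC↑))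
  x≡ : x ≡ suc α ⊎ x ≡ suc γ
  x≡ = ∈-gaps A B C (subst (x ∈_) j≡ x∈j)
         (x∉ ∘ ∈-++⁺ˡ) (x∉ ∘ ∈-++⁺ʳ A ∘ there ∘ ∈-++⁺ˡ) (x∉ ∘ ∈-++⁺ʳ A ∘ there ∘ ∈-++⁺ʳ B ∘ there)
  1+x≡ : suc x ≡ α ⊎ suc x ≡ γ
  1+x≡ = ∈-gaps A B C (subst (suc x ∈_) m≡ 1+x∈m)
           (1+x∉ ∘ ∈-++⁺ˡ) (1+x∉ ∘ ∈-++⁺ʳ A ∘ there ∘ ∈-++⁺ˡ) (1+x∉ ∘ ∈-++⁺ʳ A ∘ there ∘ ∈-++⁺ʳ B ∘ there)
  γ≡ : suc (suc α) ≡ γ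
  γ≡ with x≡ | 1+x≡
  ... | inj₁ refl | inj₂ 2+α≡γ = 2+α≡γ
  ... | inj₁ refl | inj₁ 2+α≡α = ⊥-elim (2+n≢n α 2+α≡α)
  ... | inj₂ refl | inj₁ 2+γ≡α = ⊥-elim (ℕ.m+n≮n 3 γ (subst (λ t → suc t < γ) (sym 2+γ≡α) α⁺<γ))
  ... | inj₂ refl | inj₂ 2+γ≡γ = ⊥-elim (2+n≢n γ 2+γ≡γ)

exchange⇒criterion₂ : ∀ A B β n {x} → AllPairs _<_ (A ++ suc β ∷ B ++ n ∷ []) →
  Exchange (A ++ suc β ∷ B ++ n ∷ []) (A ++ β ∷ B) x → B ≡ [] × suc (suc β) ≡ n
exchange⇒criterion₂ A B β n {x} a↑ (x∈j , x∉m , 1+x∈m , 1+x∉j) =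
  nothing-between B (subst (λ t → AllPairs _<_ (suc β ∷ B ++ t ∷ [])) (sym n≡) (allPairs-dropPrefix A a↑)) , n≡
  where
  m≡ = meet-case2 A B β n
  j≡ = join-case2 A B β n
  x∉ = subst (x ∉_) m≡ x∉m
  1+x∉ = subst (suc x ∉_) j≡ 1+x∉j
  x≡ : x ≡ suc β
  x≡ = ∈-gap A B (subst (x ∈_) j≡ x∈j) (x∉ ∘ ∈-++⁺ˡ) (x∉ ∘ ∈-++⁺ʳ A ∘ there ∘ ∈-++⁺ˡ)
  1+x≡ : suc x ≡ β ⊎ suc x ≡ n
  1+x≡ = ∈-gaps A B [] (subst (suc x ∈_) m≡ 1+x∈m) (1+x∉ ∘ ∈-++⁺ˡ) (1+x∉ ∘ ∈-++⁺ʳ A ∘ there) (λ ())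
  n≡ : suc (suc β) ≡ n
  n≡ with x≡ | 1+x≡
  ... | refl | inj₂ 2+β≡n = 2+β≡n
  ... | refl | inj₁ 2+β≡β = ⊥-elim (2+n≢n β 2+β≡β)

criterion⇒special₁ : ∀ {n} A C α →
  Valid n (A ++ α ∷ suc (suc (suc α)) ∷ C) → Valid n (A ++ suc α ∷ suc (suc α) ∷ C) →
  Special n (A ++ α ∷ suc (suc (suc α)) ∷ C) (A ++ suc α ∷ suc (suc α) ∷ C)
criterion⇒special₁ {n} A C α (1≤|a| , |a|<n , a-bd , a↑) (_ , _ , b-bd , _) =
  p , q , - 1ℚ , vp , vq , (p≼q , p≢q) , p≢meet ∘ proj₁ , (λ ()) , relation , covers
  where
  α₁ = suc α
  α₂ = suc α₁
  α₃ = suc α₂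
  a = A ++ α ∷ α₃ ∷ C
  b = A ++ α₁ ∷ α₂ ∷ C
  p = A ++ α ∷ α₁ ∷ C
  q = A ++ α₂ ∷ α₃ ∷ C
  m≡ = meet-case1 A [] C α α₂
  j≡ = join-case1 A [] C α α₂
  same-length : ∀ u v → length (A ++ u ∷ v ∷ C) ≡ length a
  same-length u v = trans (length-++ A) (sym (length-++ A))
  αα₃C-bd = ++⁻ʳ A a-bd
  α₁α₂C-bd = ++⁻ʳ A b-bd
  Aα↑,αα₃C↑ = linked-split A a↑
  vp : Valid n p
  vp = subst (1 ≤_) (sym (same-length α α₁)) 1≤|a| , subst (_< n) (sym (same-length α α₁)) |a|<n ,
       ++⁺ (++⁻ˡ A a-bd) (All.head αα₃C-bd ∷ All.head α₁α₂C-bd ∷ All.tail (All.tail αα₃C-bd)) ,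
       linked-join A (proj₁ Aα↑,αα₃C↑) (ℕ.n<1+n α ∷ linked-lower (linked-tail (proj₂ Aα↑,αα₃C↑)) (ℕ.m≤n+m α₁ 2))
  vq : Valid n q
  vq = subst (1 ≤_) (sym (same-length α₂ α₃)) 1≤|a| , subst (_< n) (sym (same-length α₂ α₃)) |a|<n ,
       ++⁺ (++⁻ˡ A a-bd) (All.head (All.tail α₁α₂C-bd) ∷ All.tail αα₃C-bd) ,
       linked-join A (linked-raiseLast A (proj₁ Aα↑,αα₃C↑) (ℕ.m≤n+m α 2)) (ℕ.n<1+n α₂ ∷ linked-tail (proj₂ Aα↑,αα₃C↑))
  p≼q : p ≼ q
  p≼q = ≼-++ A (ℕ.m≤n+m α 2 , ℕ.m≤n+m α₁ 2 , ≼-refl C)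
  p≢q : p ≢ q
  p≢q = ℕ.<⇒≢ (ℕ.m<n+m α {2} (s≤s z≤n)) ∘ ∷-injectiveˡ ∘ ++-cancelˡ A _ _
  p≢meet : p ≢ meet a b
  p≢meet p≡m = ℕ.<⇒≢ (ℕ.n<1+n α₁) (∷-injectiveˡ (∷-injectiveʳ (++-cancelˡ A _ _ (trans p≡m m≡))))
  relation : InPluckerIdeal a b (- 1ℚ) p q
  relation = inPluckerIdeal-threeTerm {a} {b} {p} {q} (λ z →
    subst₂ (λ m j → plucker z a * plucker z b - plucker z m * plucker z j + plucker z p * plucker z q ≡ 0ℚ) (sym m≡) (sym j≡)
      (threeTermPlücker z A C α α₁ α₂ α₃))
  covers : Covers n (join a b) q
  covers = subst (λ j → Covers n j q) (sym j≡) (raise-covers n A α₁ (α₃ ∷ C))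

criterion⇒special₂ : ∀ A β →
  Valid (suc (suc β)) (A ++ suc β ∷ suc (suc β) ∷ []) → Valid (suc (suc β)) (A ++ β ∷ []) →
  Special (suc (suc β)) (A ++ suc β ∷ suc (suc β) ∷ []) (A ++ β ∷ [])
criterion⇒special₂ A β (1≤|a| , |a|<n , a-bd , _) (1≤|b| , |b|<n , b-bd , b↑) =
  p , q , - 1ℚ , vp , vq , (p≼q , p≢q) , q≢join ∘ proj₂ , (λ ()) , relation , covers
  where
  β⁺ = suc β
  n = suc β⁺
  a = A ++ β⁺ ∷ n ∷ []
  b = A ++ β ∷ []
  p = A ++ β ∷ β⁺ ∷ []
  q = A ++ n ∷ []
  m≡ = meet-case2 A [] β n
  j≡ = join-case2 A [] β n
  |p|≡|a| : length p ≡ length a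
  |p|≡|a| = trans (length-++ A) (sym (length-++ A))
  |q|≡|b| : length q ≡ length b
  |q|≡|b| = trans (length-++ A) (sym (length-++ A))
  vp : Valid n p
  vp = subst (1 ≤_) (sym |p|≡|a|) 1≤|a| , subst (_< n) (sym |p|≡|a|) |a|<n ,
       ++⁺ (++⁻ˡ A a-bd) (All.head (++⁻ʳ A b-bd) ∷ All.head (++⁻ʳ A a-bd) ∷ []) ,
       linked-join A b↑ (ℕ.n<1+n β ∷ [-])
  vq : Valid n q
  vq = subst (1 ≤_) (sym |q|≡|b|) 1≤|b| , subst (_< n) (sym |q|≡|b|) |b|<n ,
       ++⁺ (++⁻ˡ A b-bd) ((s≤s z≤n , ℕ.≤-refl) ∷ []) ,
       linked-raiseLast A b↑ (ℕ.m≤n+m β 2)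
  p≼q : p ≼ q
  p≼q = ≼-++ A (ℕ.m≤n+m β 2 , tt)
  p≢q : p ≢ q
  p≢q = ℕ.<⇒≢ (ℕ.m<n+m β {2} (s≤s z≤n)) ∘ ∷-injectiveˡ ∘ ++-cancelˡ A _ _
  q≢join : q ≢ join a b
  q≢join q≡j = ℕ.<⇒≢ (ℕ.n<1+n β⁺) (sym (∷-injectiveˡ (++-cancelˡ A _ _ (trans q≡j j≡))))
  relation : InPluckerIdeal a b (- 1ℚ) p q
  relation = inPluckerIdeal-threeTerm {a} {b} {p} {q} (λ z →
    subst₂ (λ m j → plucker z a * plucker z b - plucker z m * plucker z j + plucker z p * plucker z q ≡ 0ℚ) (sym m≡) (sym j≡)
      (incidencePlücker z A β β⁺ n))
  covers : Covers n (join a b) q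
  covers = subst (λ j → Covers n j q) (sym j≡) (raise-covers n A β⁺ [])

special⇔criterion₁ : ∀ {n} A B C α γ → Valid n (A ++ α ∷ B ++ suc γ ∷ C) → Valid n (A ++ suc α ∷ B ++ γ ∷ C) →
  Special n (A ++ α ∷ B ++ suc γ ∷ C) (A ++ suc α ∷ B ++ γ ∷ C) ⇔ (B ≡ [] × suc (suc α) ≡ γ)
special⇔criterion₁ A B C α γ va vb =
  mk⇔ (exchange⇒criterion₁ A B C α γ (increasing vb) ∘ proj₂ ∘ special⇒exchange va vb separating)
      (λ { (refl , refl) → criterion⇒special₁ A C α va vb })
  where separating = Case1Witness.separates A B C α γ (increasing va) (increasing vb)

special⇔criterion₂ : ∀ {n} A B β → Valid n (A ++ suc β ∷ B ++ n ∷ []) → Valid n (A ++ β ∷ B) →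
  Special n (A ++ suc β ∷ B ++ n ∷ []) (A ++ β ∷ B) ⇔ (B ≡ [] × suc (suc β) ≡ n)
special⇔criterion₂ A B β va vb =
  mk⇔ (exchange⇒criterion₂ A B β _ (increasing va) ∘ proj₂ ∘ special⇒exchange va vb separating)
      (λ { (refl , refl) → criterion⇒special₂ A β va vb })
  where separating = Case2Witness.separates A B β _ (increasing va) (increasing vb)

at-ext : ∀ x y → length x ≡ length y → (∀ r → r < length x → at x r ≡ at y r) → x ≡ y
at-ext [] [] _ _ = refl
at-ext (u ∷ x) (v ∷ y) |x|≡|y| x≗y =
  cong₂ _∷_ (x≗y 0 (s≤s z≤n)) (at-ext x y (ℕ.suc-injective |x|≡|y|) (λ r r< → x≗y (suc r) (s≤s r<)))

at-++ˡ : ∀ A L r → r < length A → at (A ++ L) r ≡ at A r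
at-++ˡ (a ∷ A) L zero _ = refl
at-++ˡ (a ∷ A) L (suc r) (s≤s r<) = at-++ˡ A L r r<

split-last : ∀ x l → length x ≡ suc l → ∃ λ x′ → x ≡ x′ ++ at x l ∷ [] × length x′ ≡ l
split-last (u ∷ []) zero _ = [] , refl , refl
split-last (u ∷ v ∷ x) (suc l) |x|≡ with split-last (v ∷ x) l (ℕ.suc-injective |x|≡)
... | x′ , x≡ , |x′|≡l = u ∷ x′ , cong (u ∷_) x≡ , cong suc |x′|≡l

split-at-difference : ∀ s x y → length x ≡ length y → s < length x →
  (∀ r → r < length x → r ≢ s → at x r ≡ at y r) →
  ∃ λ B → ∃ λ C → x ≡ B ++ at x s ∷ C × y ≡ B ++ at y s ∷ C × length B ≡ s
split-at-difference zero (u ∷ x) (v ∷ y) |x|≡|y| _ x≗y =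
  [] , x , refl , cong (v ∷_) (sym (at-ext x y (ℕ.suc-injective |x|≡|y|) (λ r r< → x≗y (suc r) (s≤s r<) (λ ())))) , refl
split-at-difference (suc s) (u ∷ x) (v ∷ y) |x|≡|y| (s≤s s<) x≗y
  with split-at-difference s x y (ℕ.suc-injective |x|≡|y|) s< (λ r r< r≢s → x≗y (suc r) (s≤s r<) (r≢s ∘ ℕ.suc-injective))
... | B , C , x≡ , y≡ , |B|≡s =
  u ∷ B , C , cong (u ∷_) x≡ , cong₂ _∷_ (sym (x≗y 0 (s≤s z≤n) (λ ()))) y≡ , cong suc |B|≡s

split-at-differences : ∀ s t x y → length x ≡ length y → s < t → t < length x →
  (∀ r → r < length x → r ≢ s → r ≢ t → at x r ≡ at y r) →
  ∃ λ A → ∃ λ B → ∃ λ C → x ≡ A ++ at x s ∷ B ++ at x t ∷ C × y ≡ A ++ at y s ∷ B ++ at y t ∷ C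
    × length A ≡ s × length A ℕ.+ suc (length B) ≡ t
split-at-differences zero (suc t) (u ∷ x) (v ∷ y) |x|≡|y| _ (s≤s t<) x≗y
  with split-at-difference t x y (ℕ.suc-injective |x|≡|y|) t<
         (λ r r< r≢t → x≗y (suc r) (s≤s r<) (λ ()) (r≢t ∘ ℕ.suc-injective))
... | B , C , x≡ , y≡ , |B|≡t = [] , B , C , cong (u ∷_) x≡ , cong (v ∷_) y≡ , refl , cong suc |B|≡t
split-at-differences (suc s) (suc t) (u ∷ x) (v ∷ y) |x|≡|y| (s≤s s<t) (s≤s t<)  x≗y
  with split-at-differences s t x y (ℕ.suc-injective |x|≡|y|) s<t t<
         (λ r r< r≢s r≢t → x≗y (suc r) (s≤s r<) (r≢s ∘ ℕ.suc-injective) (r≢t ∘ ℕ.suc-injective))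
... | A , B , C , x≡ , y≡ , |A|≡s , |AB|≡t =
  u ∷ A , B , C , cong (u ∷_) x≡ , cong₂ _∷_ (sym (x≗y 0 (s≤s z≤n) (λ ()) (λ ()))) y≡ ,
  cong suc |A|≡s , cong suc |AB|≡t

length≡0⇒[] : ∀ (B : List ℕ) → length B ≡ 0 → B ≡ []
length≡0⇒[] [] _ = refl

transport-special : ∀ {n a b a′ b′} → a ≡ a′ → b ≡ b′ → Special n a b ⇔ Special n a′ b′
transport-special a≡ b≡ = mk⇔ (subst₂ (Special _) a≡ b≡) (subst₂ (Special _) (sym a≡) (sym b≡))

labelled-case1 : ∀ {n a b} → Valid n a → Valid n b → (h : Case1 a b) → Special n a b ⇔ Criterion n a b (inj₁ h)
labelled-case1 {n} {a} {b} va vb (|a|≡|b| , r₁ , r₂ , r₁<r₂ , r₂<|a| , a₁+1≡b₁ , a₂≡b₂+1 , agree)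
  with split-at-differences r₁ r₂ a b |a|≡|b| r₁<r₂ r₂<|a| agree
... | A , B , C , a≡ , b≡ , |A|≡r₁ , |A|+1+|B|≡r₂ =
  ⇔-trans (transport-special a≡′ b≡′)
    (⇔-trans (special⇔criterion₁ A B C α γ (subst (Valid n) a≡′ va) (subst (Valid n) b≡′ vb)) (mk⇔ to from))
  where
  α = at a r₁
  γ = at b r₂
  b₁≡ : at b r₁ ≡ suc α
  b₁≡ = trans (sym a₁+1≡b₁) (ℕ.+-comm α 1)
  a≡′ : a ≡ A ++ α ∷ B ++ suc γ ∷ C
  a≡′ = trans a≡ (cong (λ t → A ++ α ∷ B ++ t ∷ C) (trans a₂≡b₂+1 (ℕ.+-comm γ 1)))
  b≡′ : b ≡ A ++ suc α ∷ B ++ γ ∷ C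
  b≡′ = trans b≡ (cong (λ t → A ++ t ∷ B ++ γ ∷ C) b₁≡)
  b₁+1≡ : at b r₁ ℕ.+ 1 ≡ suc (suc α)
  b₁+1≡ = trans (cong (ℕ._+ 1) b₁≡) (ℕ.+-comm (suc α) 1)
  to : B ≡ [] × suc (suc α) ≡ γ → r₂ ≡ suc r₁ × at b r₁ ℕ.+ 1 ≡ at b r₂
  to (refl , 2+α≡γ) = trans (sym |A|+1+|B|≡r₂) (trans (ℕ.+-comm (length A) 1) (cong suc |A|≡r₁)) , trans b₁+1≡ 2+α≡γ
  from : r₂ ≡ suc r₁ × at b r₁ ℕ.+ 1 ≡ at b r₂ → B ≡ [] × suc (suc α) ≡ γ
  from (r₂≡1+r₁ , b₁+1≡b₂) =
    length≡0⇒[] B (ℕ.suc-injective (ℕ.+-cancelˡ-≡ (length A) _ _ |A|+1+|B|≡|A|+1)) , trans (sym b₁+1≡) b₁+1≡b₂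
    where
    |A|+1+|B|≡|A|+1 : length A ℕ.+ suc (length B) ≡ length A ℕ.+ 1
    |A|+1+|B|≡|A|+1 = trans |A|+1+|B|≡r₂ (trans r₂≡1+r₁ (trans (cong suc (sym |A|≡r₁)) (ℕ.+-comm 1 (length A))))

labelled-case2 : ∀ {n a b} → 2 ≤ n → Valid n a → Valid n b → (h : Case2 n a b) → Special n a b ⇔ Criterion n a b (inj₂ h)
labelled-case2 {n} {a} {b} 2≤n va vb (|a|≡1+|b| , aₗ≡n , r₁ , r₁<|b| , a₁≡b₁+1 , agree)
  with split-last a (length b) |a|≡1+|b|
... | a′ , a≡ , |a′|≡|b|
  with split-at-difference r₁ a′ b |a′|≡|b| (subst (r₁ <_) (sym |a′|≡|b|) r₁<|b|) agree′
  where
  agree′ : ∀ r → r < length a′ → r ≢ r₁ → at a′ r ≡ at b r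
  agree′ r r< r≢r₁ =
    trans (sym (at-++ˡ a′ _ r r<)) (trans (cong (λ l → at l r) (sym a≡)) (agree r (subst (r <_) |a′|≡|b| r<) r≢r₁))
... | A , B , a′≡ , b≡ , |A|≡r₁ =
  ⇔-trans (transport-special a≡′ b≡)
    (⇔-trans (special⇔criterion₂ A B β (subst (Valid n) a≡′ va) (subst (Valid n) b≡ vb)) (mk⇔ to from))
  where
  β = at b r₁
  a′₁≡ : at a′ r₁ ≡ suc β
  a′₁≡ = trans (sym (at-++ˡ a′ _ r₁ (subst (r₁ <_) (sym |a′|≡|b|) r₁<|b|)))
           (trans (cong (λ l → at l r₁) (sym a≡)) (trans a₁≡b₁+1 (ℕ.+-comm β 1)))
  a≡′ : a ≡ A ++ suc β ∷ B ++ n ∷ []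
  a≡′ = trans a≡ (trans (cong₂ (λ l t → l ++ t ∷ []) (trans a′≡ (cong (λ t → A ++ t ∷ B) a′₁≡)) aₗ≡n)
                         (++-assoc A (suc β ∷ B) (n ∷ [])))
  |b|≡ : length b ≡ length A ℕ.+ suc (length B)
  |b|≡ = trans (cong length b≡) (length-++ A)
  to : B ≡ [] × suc (suc β) ≡ n → suc r₁ ≡ length b × at b r₁ ≡ n ∸ 2
  to (refl , refl) = trans (cong suc (sym |A|≡r₁)) (trans (ℕ.+-comm 1 (length A)) (sym |b|≡)) , refl
  from : suc r₁ ≡ length b × at b r₁ ≡ n ∸ 2 → B ≡ [] × suc (suc β) ≡ n
  from (1+r₁≡|b| , β≡n∸2) =
    length≡0⇒[] B (ℕ.suc-injective (ℕ.+-cancelˡ-≡ (length A) _ _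
      (sym (trans (ℕ.+-comm (length A) 1) (trans (cong suc |A|≡r₁) (trans 1+r₁≡|b| |b|≡)))))) ,
    trans (ℕ.+-comm 2 β) (trans (cong (ℕ._+ 2) β≡n∸2) (ℕ.m∸n+n≡m 2≤n))

-- The labelling h already determines a ∧ b and a ∨ b.
proposition3p15 : (n : ℕ) → 2 ≤ n → (a b : List ℕ) → Valid n a → Valid n b →
                    DiamondPair n a b → (h : Case1 a b ⊎ Case2 n a b) →
                    Special n a b ⇔ Criterion n a b h
proposition3p15 n 2≤n a b va vb _ (inj₁ h) = labelled-case1 va vb h
proposition3p15 n 2≤n a b va vb _ (inj₂ h) = labelled-case2 2≤n va vb h
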